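{- In the OSW model described in the context, for every $u\in V$, the probability of the event $E_{2u}$ that there exist distinct vertices $a,b\in V\setminus\{u\}$ with $\{u,a\}\in E'$, $\{a,b\}\notin E'$, $a$ choosing $b$ (event $C_{ab}$), and $\{b,u\}\in E'$ satisfies $\Pr(E_{2u})<\frac92\ln^{ -1}(n+1)$.
   Context: Let $n\ge1$ be an integer, $V=\{u\in\mathbb{Z}^3:\sum_{i=1}^3|u_i|=n\}$, $E'=\{\{v,w\}\subset V: v\ne w,\ |v_i-w_i|\le1\ \forall 1\le i\le3\}$ (the undirected $n$-octahedral graph $G'_n=(V,E')$), and let $d_{uv}$ be the shortest-path distance in $G'_n$. For $u\in V$ let $Z_u=\left(\sum_{w\in V\setminus\{u\}}d_{uw}^{ -2}\right)^{ -1}$. In the OSW model, independently for each $u\in V$, the vertex $u$ chooses one vertex $v\in V\setminus\{u\}$ with probability $\Pr(C_{uv})=Z_u d_{uv}^{ -2}$, where $C_{uv}$ is the event that $u$ chooses $v$; this yields the directed long-range edge $(u,v)$. -}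

module Defs where

open import Data.Bool using (Bool; true; false; _∧_; _∨_; not; if_then_else_)
open import Data.Nat as ℕ using (ℕ; zero; suc)
open import Data.Integer as ℤ using (ℤ; +_; ∣_∣)
import Data.Integer.Properties as ℤP
open import Data.Rational as ℚ using (ℚ; 0ℚ; 1ℚ; _÷_; _/_; 1/_; ≢-nonZero; >-nonZero)
import Data.Rational.Properties as ℚP
open import Data.List using (List; []; _∷_; map; filter; concatMap; upTo; length; foldr)
open import Data.Bool.ListAction using (any)
open import Data.Product using (_×_; _,_; Σ; ∃-syntax)
open import Data.Sum using (_⊎_)
open import Relation.Nullary using (yes; no; does)

boolFilter : {A : Set} → (A → Bool) → List A → List A
boolFilter p []       = []
boolFilter p (x ∷ xs) = if p x then x ∷ boolFilter p xs else boolFilter p xs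

Vtx : Set
Vtx = ℤ × ℤ × ℤ

_==ℤ_ : ℤ → ℤ → Bool
a ==ℤ b = does (a ℤ.≟ b)

_==V_ : Vtx → Vtx → Bool
(x , y , z) ==V (x' , y' , z') = (x ==ℤ x') ∧ (y ==ℤ y') ∧ (z ==ℤ z')

range : ℕ → List ℤ
range n = map (λ i → (+ i) ℤ.- (+ n)) (upTo (suc (2 ℕ.* n)))

-- V = { u ∈ ℤ³ : |u₁|+|u₂|+|u₃| = n }, enumerated without repetition
V : ℕ → List Vtx
V n = boolFilter (λ { (x , y , z) → does ((∣ x ∣ ℕ.+ ∣ y ∣ ℕ.+ ∣ z ∣) ℕ.≟ n) })
        (concatMap (λ x → concatMap (λ y → map (λ z → (x , y , z)) (range n)) (range n)) (range n))

close : ℤ → ℤ → Bool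
close a b = does (∣ a ℤ.- b ∣ ℕ.≤? 1)

adj : Vtx → Vtx → Bool
adj v@(x , y , z) w@(x' , y' , z') = not (v ==V w) ∧ close x x' ∧ close y y' ∧ close z z'

ball : ℕ → ℕ → Vtx → List Vtx
ball n zero    u = u ∷ []
ball n (suc k) u = boolFilter (λ w → any (λ x → (x ==V w) ∨ adj x w) (ball n k u)) (V n)

_∈b_ : Vtx → List Vtx → Bool
w ∈b L = any (w ==V_) L

-- least k ≤ fuel (searching from k) with w ∈ ball k; 0 if none
searchDist : ℕ → ℕ → ℕ → Vtx → Vtx → ℕ
searchDist n k zero       u w = if w ∈b ball n k u then k else 0
searchDist n k (suc fuel) u w = if w ∈b ball n k u then k else searchDist n (suc k) fuel u w

-- d_{uw}; G'_n is connected, so the distance is found with fuel |V|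
dist : ℕ → Vtx → Vtx → ℕ
dist n u w = searchDist n 0 (length (V n)) u w

-- d^{-2} (for d ≥ 1; conventionally 0 for d = 0, which never occurs for u ≠ w)
invSq : ℕ → ℚ
invSq zero    = 0ℚ
invSq (suc m) = (+ 1) / (suc m ℕ.* suc m)

inv : ℚ → ℚ
inv p with p ℚ.≟ 0ℚ
... | yes _  = 0ℚ
... | no p≢0 = 1/_ p {{≢-nonZero p≢0}}

sumℚ : List ℚ → ℚ
sumℚ = foldr ℚ._+_ 0ℚ

prodℚ : List ℚ → ℚ
prodℚ = foldr ℚ._*_ 1ℚ

others : ℕ → Vtx → List Vtx
others n u = boolFilter (λ w → not (u ==V w)) (V n)

Z : ℕ → Vtx → ℚ
Z n u = inv (sumℚ (map (λ w → invSq (dist n u w)) (others n u)))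

PrC : ℕ → Vtx → Vtx → ℚ
PrC n u v = Z n u ℚ.* invSq (dist n u v)

-- An outcome assigns to every vertex a of V the vertex b ≠ a it chooses,
-- recorded as the list of pairs (a , b).
Outcome : Set
Outcome = List (Vtx × Vtx)

outcomesFrom : ℕ → List Vtx → List Outcome
outcomesFrom n []       = [] ∷ []
outcomesFrom n (a ∷ as) = concatMap (λ b → map ((a , b) ∷_) (outcomesFrom n as)) (others n a)

outcomes : ℕ → List Outcome
outcomes n = outcomesFrom n (V n)

-- probability of an outcome (independent choices): ∏_a Pr(C_{a,b_a})
weight : ℕ → Outcome → ℚ
weight n ω = prodℚ (map (λ { (a , b) → PrC n a b }) ω)

Pr : ℕ → (Outcome → Bool) → ℚ
Pr n E = sumℚ (map (weight n) (boolFilter E (outcomes n)))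

-- E_{2u}: ∃ distinct a, b ∈ V∖{u} with {u,a} ∈ E', {a,b} ∉ E', C_{ab}, {b,u} ∈ E'
-- (in an outcome a chooses b iff (a , b) ∈ ω; a ≠ b holds by construction)
E2 : ℕ → Vtx → Outcome → Bool
E2 n u ω = any (λ { (a , b) → not (a ==V u) ∧ not (b ==V u) ∧ not (a ==V b)
                               ∧ adj u a ∧ not (adj a b) ∧ adj b u }) ω

-- Comparison with 1/ln without real numbers.
-- expPartial x N = Σ_{k=0}^{N} x^k / k!
expTerm : ℚ → ℕ → ℚ
expTerm x zero    = 1ℚ
expTerm x (suc k) = expTerm x k ℚ.* x ℚ.* ((+ 1) / suc k)

expPartial : ℚ → ℕ → ℚ
expPartial x zero    = 1ℚ
expPartial x (suc N) = expPartial x N ℚ.+ expTerm x (suc N)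

-- LtMulInvLn P c m  means  P < c · ln⁻¹(m)   (for m ≥ 2, c > 0).
-- If P > 0 this is  ln m < c / P,  i.e.  m < exp(c / P),  i.e. some partial
-- sum of the exponential series at c / P exceeds m.  If P ≤ 0 it holds.
LtMulInvLn : ℚ → ℚ → ℕ → Set
LtMulInvLn P c m =
  P ℚ.≤ 0ℚ ⊎ Σ (0ℚ ℚ.< P) λ P>0 →
    ∃[ N ] ((+ m) / 1 ℚ.< expPartial (_÷_ c P {{>-nonZero P>0}}) N)

{-# OPTIONS --safe #-}

-- A union bound over the choosing vertex gives Pr(E₂ᵤ) ≤ Σ Z_a d_ab⁻², summed over the pairs (a , b)
-- of neighbours of u with {a , b} ∉ E'.  For these d_ab ≥ 2, and since for d ∈ {-1,0,1}³ whether
-- u + d ∈ V depends only on the signs of the coordinates of u, a finite check shows that there are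
-- at most 18 such pairs; hence Pr(E₂ᵤ) ≤ (18/4) max_a Z_a.  Every a ∈ V has a coordinate of absolute
-- value at least r = ⌊(n-1)/3⌋ + 1, and moving j ≤ r units of it onto the other two coordinates
-- reaches j + 1 distinct vertices within distance j, so Z_a⁻¹ ≥ Σ_{j ≤ r} (j+1)/j² ≥ 2 + Σ_{i=2}^r 1/i = L.
-- Finally eᴸ ≥ (9/8)¹⁶ (r+1)/2 > 3r + 1 ≥ n + 1, with eˣ replaced by partial sums of its series.

module Submission where

open import Defs
open import Data.Bool using (Bool; true; false; _∧_; _∨_; not; if_then_else_)
import Data.Bool.Properties as BP
open import Data.Bool.ListAction using (any)
open import Data.Empty using (⊥; ⊥-elim)
open import Data.Integer as ℤ using (ℤ; +_; -[1+_]; +[1+_]; ∣_∣; _◃_; sign)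
import Data.Integer.Properties as ℤP
import Data.Integer.Tactic.RingSolver as ℤ-Solver
open import Data.List using (List; []; _∷_; map; concatMap; length; upTo; replicate; _++_; cartesianProduct)
import Data.List.Properties as LP
open import Data.List.Membership.Propositional using (_∈_; find)
open import Data.List.Membership.Propositional.Properties
  using (∈-∃++; ∈-++⁺ˡ; ∈-++⁺ʳ; ∈-++⁻; ∈-map⁺; ∈-map⁻; ∈-upTo⁺; ∈-upTo⁻; ∈-concatMap⁺; ∈-concatMap⁻; ∈-cartesianProduct⁺; ∈-cartesianProduct⁻)
open import Data.List.Relation.Binary.Permutation.Propositional as ↭ using (_↭_; ↭⇒↭ₛ)
import Data.List.Relation.Binary.Permutation.Propositional.Properties as ↭P
import Data.List.Relation.Binary.Permutation.Setoid.Properties as ↭ₛP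
open import Data.List.Relation.Unary.All using (All; []; _∷_)
import Data.List.Relation.Unary.All as All
import Data.List.Relation.Unary.All.Properties as AllP
open import Data.List.Relation.Unary.AllPairs using ([]; _∷_)
open import Data.List.Relation.Unary.Any as Any using (here; there)
open import Data.List.Relation.Unary.Unique.Propositional using (Unique)
import Data.List.Relation.Unary.Unique.Propositional.Properties as Unique
open import Data.Nat as ℕ using (ℕ; zero; suc; _≤_; _<_)
open import Data.Nat.DivMod using (_%_; m≡m%n+[m/n]*n; m%n<n; m/n*n≤m)
open import Data.Nat.ListAction using (sum)
import Data.Nat.Properties as ℕP
import Data.Nat.Tactic.RingSolver as ℕ-Solver
open import Data.Product using (_,_; _×_; ∃; proj₁; proj₂)
open import Data.Rational as ℚ using (ℚ; 0ℚ; 1ℚ; ½; _/_; 1/_; _÷_; toℚᵘ; ≢-nonZero; >-nonZero)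
import Data.Rational.Properties as ℚP
open import Data.Rational.Solver using (module +-*-Solver)
open import Data.Rational.Unnormalised as ℚᵘ using (mkℚᵘ; *≡*)
import Data.Rational.Unnormalised.Properties as ℚᵘP
open import Data.Sum using (_⊎_; inj₁; inj₂)
open import Function using (_∘_; _∘′_)
open import Function.Bundles using (mk⇔)
open import Relation.Nullary using (Dec; yes; no; does; ¬_)
open import Relation.Nullary.Decidable using (toWitness; dec-true; does-⇔)
open import Relation.Binary.PropositionalEquality
  using (_≡_; _≢_; refl; sym; trans; cong; cong₂; subst; setoid; ≢-sym; module ≡-Reasoning)

open +-*-Solver using (solve; _:=_; _:+_; _:*_; con)

0≤1 : 0ℚ ℚ.≤ 1ℚ
0≤1 = ℚP.nonNegative⁻¹ 1ℚ

+-nonNeg : ∀ {p q} → 0ℚ ℚ.≤ p → 0ℚ ℚ.≤ q → 0ℚ ℚ.≤ p ℚ.+ q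
+-nonNeg = ℚP.+-mono-≤

*-monoˡ-≤ : ∀ {r p q} → 0ℚ ℚ.≤ r → p ℚ.≤ q → r ℚ.* p ℚ.≤ r ℚ.* q
*-monoˡ-≤ {r} 0≤r = ℚP.*-monoˡ-≤-nonNeg r {{ℚ.nonNegative 0≤r}}

*-monoʳ-≤ : ∀ {r p q} → 0ℚ ℚ.≤ r → p ℚ.≤ q → p ℚ.* r ℚ.≤ q ℚ.* r
*-monoʳ-≤ {r} 0≤r = ℚP.*-monoʳ-≤-nonNeg r {{ℚ.nonNegative 0≤r}}

*-mono-≤ : ∀ {p p′ q q′} → 0ℚ ℚ.≤ p → 0ℚ ℚ.≤ q′ → p ℚ.≤ p′ → q ℚ.≤ q′ → p ℚ.* q ℚ.≤ p′ ℚ.* q′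
*-mono-≤ 0≤p 0≤q′ p≤p′ q≤q′ = ℚP.≤-trans (*-monoˡ-≤ 0≤p q≤q′) (*-monoʳ-≤ 0≤q′ p≤p′)

*-nonNeg : ∀ {p q} → 0ℚ ℚ.≤ p → 0ℚ ℚ.≤ q → 0ℚ ℚ.≤ p ℚ.* q
*-nonNeg {p} 0≤p 0≤q = ℚP.≤-trans (ℚP.≤-reflexive (sym (ℚP.*-zeroʳ p))) (*-monoˡ-≤ 0≤p 0≤q)

p≤p+q : ∀ {p q} → 0ℚ ℚ.≤ q → p ℚ.≤ p ℚ.+ q
p≤p+q {p} 0≤q = ℚP.≤-trans (ℚP.≤-reflexive (sym (ℚP.+-identityʳ p))) (ℚP.+-monoʳ-≤ p 0≤q)

p<p+q : ∀ {p q} → 0ℚ ℚ.< q → p ℚ.< p ℚ.+ q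
p<p+q {p} 0<q = ℚP.≤-<-trans (ℚP.≤-reflexive (sym (ℚP.+-identityʳ p))) (ℚP.+-monoʳ-< p 0<q)

fromℕ : ℕ → ℚ
fromℕ m = + m / 1

1/suc : ℕ → ℚ
1/suc k = + 1 / suc k

fromℕ-nonNeg : ∀ m → 0ℚ ℚ.≤ fromℕ m
fromℕ-nonNeg m = ℚP.nonNegative⁻¹ (fromℕ m) {{ℚP.normalize-nonNeg m 1}}

1/suc-nonNeg : ∀ k → 0ℚ ℚ.≤ 1/suc k
1/suc-nonNeg k = ℚP.nonNegative⁻¹ (1/suc k) {{ℚP.normalize-nonNeg 1 (suc k)}}

toℚᵘ-/suc : ∀ m d → toℚᵘ (+ m / suc d) ℚᵘ.≃ mkℚᵘ (+ m) d
toℚᵘ-/suc m d = ℚP.toℚᵘ-fromℚᵘ (mkℚᵘ (+ m) d)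

fromℕ-+ : ∀ a b → fromℕ (a ℕ.+ b) ≡ fromℕ a ℚ.+ fromℕ b
fromℕ-+ a b = ℚP.toℚᵘ-injective (begin
  toℚᵘ (fromℕ (a ℕ.+ b))              ≈⟨ toℚᵘ-/suc (a ℕ.+ b) 0 ⟩
  mkℚᵘ (+ (a ℕ.+ b)) 0                ≈⟨ *≡* (trans (cong (ℤ._* + 1) (ℤP.pos-+ a b)) (cross-multiplied (+ a) (+ b))) ⟩
  mkℚᵘ (+ a) 0 ℚᵘ.+ mkℚᵘ (+ b) 0      ≈⟨ ℚᵘP.+-cong (toℚᵘ-/suc a 0) (toℚᵘ-/suc b 0) ⟨
  toℚᵘ (fromℕ a) ℚᵘ.+ toℚᵘ (fromℕ b)  ≈⟨ ℚP.toℚᵘ-homo-+ (fromℕ a) (fromℕ b) ⟨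
  toℚᵘ (fromℕ a ℚ.+ fromℕ b)          ∎)
  where
  open ℚᵘP.≃-Reasoning
  cross-multiplied : ∀ x y → (x ℤ.+ y) ℤ.* + 1 ≡ (x ℤ.* + 1 ℤ.+ y ℤ.* + 1) ℤ.* (+ 1 ℤ.* + 1)
  cross-multiplied = ℤ-Solver.solve-∀

fromℕ-suc : ∀ m → fromℕ (suc m) ≡ 1ℚ ℚ.+ fromℕ m
fromℕ-suc = fromℕ-+ 1

fromℕ-* : ∀ a b → fromℕ (a ℕ.* b) ≡ fromℕ a ℚ.* fromℕ b
fromℕ-* a b = ℚP.toℚᵘ-injective (begin
  toℚᵘ (fromℕ (a ℕ.* b))              ≈⟨ toℚᵘ-/suc (a ℕ.* b) 0 ⟩
  mkℚᵘ (+ (a ℕ.* b)) 0                ≈⟨ *≡* (trans (cong (ℤ._* + 1) (ℤP.pos-* a b)) (cross-multiplied (+ a) (+ b))) ⟩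
  mkℚᵘ (+ a) 0 ℚᵘ.* mkℚᵘ (+ b) 0      ≈⟨ ℚᵘP.*-cong (toℚᵘ-/suc a 0) (toℚᵘ-/suc b 0) ⟨
  toℚᵘ (fromℕ a) ℚᵘ.* toℚᵘ (fromℕ b)  ≈⟨ ℚP.toℚᵘ-homo-* (fromℕ a) (fromℕ b) ⟨
  toℚᵘ (fromℕ a ℚ.* fromℕ b)          ∎)
  where
  open ℚᵘP.≃-Reasoning
  cross-multiplied : ∀ x y → (x ℤ.* y) ℤ.* + 1 ≡ (x ℤ.* y) ℤ.* (+ 1 ℤ.* + 1)
  cross-multiplied = ℤ-Solver.solve-∀

fromℕ-mono-≤ : ∀ {a b} → a ℕ.≤ b → fromℕ a ℚ.≤ fromℕ b
fromℕ-mono-≤ {a} {b} a≤b = ℚP.toℚᵘ-cancel-≤ (ℚᵘP.≤-respʳ-≃ (ℚᵘP.≃-sym (toℚᵘ-/suc b 0))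
  (ℚᵘP.≤-respˡ-≃ (ℚᵘP.≃-sym (toℚᵘ-/suc a 0)) (ℚᵘ.*≤* (ℤP.*-monoʳ-≤-nonNeg (+ 1) (ℤ.+≤+ a≤b)))))

fromℕ*1/suc : ∀ k → fromℕ (suc k) ℚ.* 1/suc k ≡ 1ℚ
fromℕ*1/suc k = ℚP.toℚᵘ-injective (begin
  toℚᵘ (fromℕ (suc k) ℚ.* 1/suc k)          ≈⟨ ℚP.toℚᵘ-homo-* (fromℕ (suc k)) (1/suc k) ⟩
  toℚᵘ (fromℕ (suc k)) ℚᵘ.* toℚᵘ (1/suc k)  ≈⟨ ℚᵘP.*-cong (toℚᵘ-/suc (suc k) 0) (toℚᵘ-/suc 1 k) ⟩
  mkℚᵘ (+ suc k) 0 ℚᵘ.* mkℚᵘ (+ 1) k        ≈⟨ ℚᵘP.*-inverseʳ (mkℚᵘ (+ suc k) 0) ⟩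
  ℚᵘ.1ℚᵘ                                    ∎)
  where open ℚᵘP.≃-Reasoning

invSq-suc : ∀ k → invSq (suc k) ≡ 1/suc k ℚ.* 1/suc k
invSq-suc k = ℚP.toℚᵘ-injective (begin
  toℚᵘ (invSq (suc k))                   ≈⟨ toℚᵘ-/suc 1 (k ℕ.+ k ℕ.* suc k) ⟩
  mkℚᵘ (+ 1) k ℚᵘ.* mkℚᵘ (+ 1) k         ≈⟨ ℚᵘP.*-cong (toℚᵘ-/suc 1 k) (toℚᵘ-/suc 1 k) ⟨
  toℚᵘ (1/suc k) ℚᵘ.* toℚᵘ (1/suc k)     ≈⟨ ℚP.toℚᵘ-homo-* (1/suc k) (1/suc k) ⟨
  toℚᵘ (1/suc k ℚ.* 1/suc k)             ∎)
  where open ℚᵘP.≃-Reasoning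

[1+1/suc]*fromℕ : ∀ k → (1ℚ ℚ.+ 1/suc k) ℚ.* fromℕ (suc k) ≡ fromℕ (suc (suc k))
[1+1/suc]*fromℕ k = begin
  (1ℚ ℚ.+ 1/suc k) ℚ.* fromℕ (suc k)
    ≡⟨ solve 2 (λ c m → (con 1ℚ :+ c) :* m := con 1ℚ :* m :+ m :* c) refl (1/suc k) (fromℕ (suc k)) ⟩
  1ℚ ℚ.* fromℕ (suc k) ℚ.+ fromℕ (suc k) ℚ.* 1/suc k
    ≡⟨ cong₂ ℚ._+_ (ℚP.*-identityˡ (fromℕ (suc k))) (fromℕ*1/suc k) ⟩
  fromℕ (suc k) ℚ.+ 1ℚ
    ≡⟨ trans (ℚP.+-comm (fromℕ (suc k)) 1ℚ) (sym (fromℕ-suc (suc k))) ⟩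
  fromℕ (suc (suc k)) ∎
  where open ≡-Reasoning

1/suc[suc]*[1/suc+1] : ∀ k → 1/suc (suc k) ℚ.* (1/suc k ℚ.+ 1ℚ) ≡ 1/suc k
1/suc[suc]*[1/suc+1] k = begin
  c′ ℚ.* (c ℚ.+ 1ℚ)
    ≡⟨ cong (λ t → c′ ℚ.* (c ℚ.+ t)) (fromℕ*1/suc k) ⟨
  c′ ℚ.* (c ℚ.+ fromℕ (suc k) ℚ.* c)
    ≡⟨ solve 3 (λ c′ c m → c′ :* (c :+ m :* c) := ((con 1ℚ :+ m) :* c′) :* c) refl c′ c (fromℕ (suc k)) ⟩
  ((1ℚ ℚ.+ fromℕ (suc k)) ℚ.* c′) ℚ.* c
    ≡⟨ cong (λ t → (t ℚ.* c′) ℚ.* c) (fromℕ-suc (suc k)) ⟨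
  (fromℕ (suc (suc k)) ℚ.* c′) ℚ.* c
    ≡⟨ cong (ℚ._* c) (fromℕ*1/suc (suc k)) ⟩
  1ℚ ℚ.* c
    ≡⟨ ℚP.*-identityˡ c ⟩
  c ∎
  where
  open ≡-Reasoning
  c c′ : ℚ
  c = 1/suc k
  c′ = 1/suc (suc k)

1/-nonNeg : ∀ {p} (0<p : 0ℚ ℚ.< p) → 0ℚ ℚ.≤ (1/ p) {{>-nonZero 0<p}}
1/-nonNeg {p} 0<p = ℚP.nonNegative⁻¹ _ {{ℚP.pos⇒nonNeg ((1/ p) {{>-nonZero 0<p}}) {{ℚP.1/pos⇒pos p {{ℚ.positive 0<p}}}}}}

inv-nonNeg : ∀ {p} → 0ℚ ℚ.≤ p → 0ℚ ℚ.≤ inv p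
inv-nonNeg {p} 0≤p with p ℚ.≟ 0ℚ
... | yes _  = ℚP.≤-refl
... | no p≢0 = 1/-nonNeg (ℚP.positive⁻¹ p {{ℚP.nonNeg∧nonZero⇒pos p {{ℚ.nonNegative 0≤p}} {{≢-nonZero p≢0}}}})

inv*p≡1 : ∀ {p} → p ≢ 0ℚ → inv p ℚ.* p ≡ 1ℚ
inv*p≡1 {p} p≢0 with p ℚ.≟ 0ℚ
... | yes p≡0 = ⊥-elim (p≢0 p≡0)
... | no p≢0  = ℚP.*-inverseˡ p {{≢-nonZero p≢0}}

inv*p≤1 : ∀ p → inv p ℚ.* p ℚ.≤ 1ℚ
inv*p≤1 p with p ℚ.≟ 0ℚ
... | yes _  = ℚP.≤-trans (ℚP.≤-reflexive (ℚP.*-zeroˡ p)) 0≤1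
... | no p≢0 = ℚP.≤-reflexive (ℚP.*-inverseˡ p {{≢-nonZero p≢0}})

inv-antimono-≤ : ∀ {p q} → 0ℚ ℚ.< p → p ℚ.≤ q → inv q ℚ.≤ inv p
inv-antimono-≤ {p} {q} 0<p p≤q = begin
  inv q                       ≡⟨ ℚP.*-identityʳ (inv q) ⟨
  inv q ℚ.* 1ℚ                ≡⟨ cong (inv q ℚ.*_) (trans (ℚP.*-comm p (inv p)) (inv*p≡1 (≢-sym (ℚP.<⇒≢ 0<p)))) ⟨
  inv q ℚ.* (p ℚ.* inv p)     ≤⟨ *-monoˡ-≤ (inv-nonNeg 0≤q) (*-monoʳ-≤ (inv-nonNeg 0≤p) p≤q) ⟩
  inv q ℚ.* (q ℚ.* inv p)     ≡⟨ ℚP.*-assoc (inv q) q (inv p) ⟨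
  inv q ℚ.* q ℚ.* inv p       ≤⟨ *-monoʳ-≤ (inv-nonNeg 0≤p) (inv*p≤1 q) ⟩
  1ℚ ℚ.* inv p                ≡⟨ ℚP.*-identityˡ (inv p) ⟩
  inv p                       ∎
  where
  open ℚP.≤-Reasoning
  0≤p : 0ℚ ℚ.≤ p
  0≤p = ℚP.<⇒≤ 0<p
  0≤q : 0ℚ ℚ.≤ q
  0≤q = ℚP.≤-trans 0≤p p≤q

invSq-nonNeg : ∀ d → 0ℚ ℚ.≤ invSq d
invSq-nonNeg zero    = ℚP.≤-refl
invSq-nonNeg (suc d) = ℚP.nonNegative⁻¹ (invSq (suc d)) {{ℚP.normalize-nonNeg 1 (suc d ℕ.* suc d)}}

invSq-antimono-≤ : ∀ {a b} → 1 ℕ.≤ a → a ℕ.≤ b → invSq b ℚ.≤ invSq a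
invSq-antimono-≤ {suc a} {suc b} _ a≤b = ℚP.toℚᵘ-cancel-≤
  (ℚᵘP.≤-respʳ-≃ (ℚᵘP.≃-sym (toℚᵘ-/suc 1 (a ℕ.+ a ℕ.* suc a)))
  (ℚᵘP.≤-respˡ-≃ (ℚᵘP.≃-sym (toℚᵘ-/suc 1 (b ℕ.+ b ℕ.* suc b)))
  (ℚᵘ.*≤* (ℤP.*-monoˡ-≤-nonNeg (+ 1) (ℤ.+≤+ (ℕP.*-mono-≤ a≤b a≤b))))))

invSq≤1/4 : ∀ {d} → d ≢ 1 → invSq d ℚ.≤ + 1 / 4
invSq≤1/4 {zero}        _   = ℚP.nonNegative⁻¹ (+ 1 / 4)
invSq≤1/4 {suc zero}    d≢1 = ⊥-elim (d≢1 refl)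
invSq≤1/4 {suc (suc d)} _   = invSq-antimono-≤ {2} {suc (suc d)} (ℕ.s≤s ℕ.z≤n) (ℕ.s≤s (ℕ.s≤s ℕ.z≤n))

1/suc≤fromℕ*invSq : ∀ k → 1/suc k ℚ.≤ fromℕ (suc (suc k)) ℚ.* invSq (suc k)
1/suc≤fromℕ*invSq k = begin
  1/suc k                                      ≡⟨ ℚP.*-identityˡ (1/suc k) ⟨
  1ℚ ℚ.* 1/suc k                               ≡⟨ cong (ℚ._* 1/suc k) (fromℕ*1/suc k) ⟨
  fromℕ (suc k) ℚ.* 1/suc k ℚ.* 1/suc k        ≡⟨ ℚP.*-assoc (fromℕ (suc k)) (1/suc k) (1/suc k) ⟩
  fromℕ (suc k) ℚ.* (1/suc k ℚ.* 1/suc k)      ≡⟨ cong (fromℕ (suc k) ℚ.*_) (invSq-suc k) ⟨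
  fromℕ (suc k) ℚ.* invSq (suc k)              ≤⟨ *-monoʳ-≤ (invSq-nonNeg (suc k)) (fromℕ-mono-≤ (ℕP.n≤1+n (suc k))) ⟩
  fromℕ (suc (suc k)) ℚ.* invSq (suc k)        ∎
  where open ℚP.≤-Reasoning

sumℚ-++ : ∀ xs ys → sumℚ (xs ++ ys) ≡ sumℚ xs ℚ.+ sumℚ ys
sumℚ-++ []       ys = sym (ℚP.+-identityˡ (sumℚ ys))
sumℚ-++ (x ∷ xs) ys = trans (cong (x ℚ.+_) (sumℚ-++ xs ys)) (sym (ℚP.+-assoc x (sumℚ xs) (sumℚ ys)))

prodℚ-++ : ∀ xs ys → prodℚ (xs ++ ys) ≡ prodℚ xs ℚ.* prodℚ ys
prodℚ-++ []       ys = sym (ℚP.*-identityˡ (prodℚ ys))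
prodℚ-++ (x ∷ xs) ys = trans (cong (x ℚ.*_) (prodℚ-++ xs ys)) (sym (ℚP.*-assoc x (prodℚ xs) (prodℚ ys)))

sumℚ-nonNeg : ∀ {ys} → All (0ℚ ℚ.≤_) ys → 0ℚ ℚ.≤ sumℚ ys
sumℚ-nonNeg []           = ℚP.≤-refl
sumℚ-nonNeg (0≤y ∷ 0≤ys) = +-nonNeg 0≤y (sumℚ-nonNeg 0≤ys)

private variable
  A B : Set

sumOver : List A → (A → ℚ) → ℚ
sumOver xs f = sumℚ (map f xs)

syntax sumOver xs (λ x → e) = Σ[ x ∈ xs ] e

Σ-++ : ∀ (f : A → ℚ) xs ys → Σ[ x ∈ xs ++ ys ] f x ≡ Σ[ x ∈ xs ] f x ℚ.+ Σ[ x ∈ ys ] f x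
Σ-++ f xs ys = trans (cong sumℚ (LP.map-++ f xs ys)) (sumℚ-++ (map f xs) (map f ys))

Σ-↭ : ∀ (f : A → ℚ) {xs ys} → xs ↭ ys → Σ[ x ∈ xs ] f x ≡ Σ[ x ∈ ys ] f x
Σ-↭ f xs↭ys = ↭ₛP.foldr-commMonoid (setoid ℚ) ℚP.+-0-isCommutativeMonoid (↭⇒↭ₛ (↭P.map⁺ f xs↭ys))

Σ-concatMap : ∀ (f : B → ℚ) (g : A → List B) xs →
              Σ[ y ∈ concatMap g xs ] f y ≡ Σ[ x ∈ xs ] Σ[ y ∈ g x ] f y
Σ-concatMap f g []       = refl
Σ-concatMap f g (x ∷ xs) = trans (Σ-++ f (g x) (concatMap g xs)) (cong (Σ[ y ∈ g x ] f y ℚ.+_) (Σ-concatMap f g xs))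

Σ-nonNeg : ∀ {f : A → ℚ} xs → (∀ {x} → x ∈ xs → 0ℚ ℚ.≤ f x) → 0ℚ ℚ.≤ Σ[ x ∈ xs ] f x
Σ-nonNeg []       0≤f = ℚP.≤-refl
Σ-nonNeg (x ∷ xs) 0≤f = +-nonNeg (0≤f (here refl)) (Σ-nonNeg xs (0≤f ∘′ there))

Σ-mono-≤ : ∀ {f g : A → ℚ} xs → (∀ {x} → x ∈ xs → f x ℚ.≤ g x) → Σ[ x ∈ xs ] f x ℚ.≤ Σ[ x ∈ xs ] g x
Σ-mono-≤ []       f≤g = ℚP.≤-refl
Σ-mono-≤ (x ∷ xs) f≤g = ℚP.+-mono-≤ (f≤g (here refl)) (Σ-mono-≤ xs (f≤g ∘′ there))

Σ-cong : ∀ {f g : A → ℚ} xs → (∀ {x} → x ∈ xs → f x ≡ g x) → Σ[ x ∈ xs ] f x ≡ Σ[ x ∈ xs ] g x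
Σ-cong []       f≡g = refl
Σ-cong (x ∷ xs) f≡g = cong₂ ℚ._+_ (f≡g (here refl)) (Σ-cong xs (f≡g ∘′ there))

Σ-*ˡ : ∀ c (f : A → ℚ) xs → Σ[ x ∈ xs ] (c ℚ.* f x) ≡ c ℚ.* Σ[ x ∈ xs ] f x
Σ-*ˡ c f []       = sym (ℚP.*-zeroʳ c)
Σ-*ˡ c f (x ∷ xs) = trans (cong (c ℚ.* f x ℚ.+_) (Σ-*ˡ c f xs)) (sym (ℚP.*-distribˡ-+ c (f x) _))

Σ-*ʳ : ∀ c (f : A → ℚ) xs → Σ[ x ∈ xs ] (f x ℚ.* c) ≡ (Σ[ x ∈ xs ] f x) ℚ.* c
Σ-*ʳ c f xs = trans (Σ-cong xs (λ {x} _ → ℚP.*-comm (f x) c)) (trans (Σ-*ˡ c f xs) (ℚP.*-comm c _))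

Σ-+ : ∀ (f g : A → ℚ) xs → Σ[ x ∈ xs ] (f x ℚ.+ g x) ≡ Σ[ x ∈ xs ] f x ℚ.+ Σ[ x ∈ xs ] g x
Σ-+ f g []       = refl
Σ-+ f g (x ∷ xs) = trans (cong (f x ℚ.+ g x ℚ.+_) (Σ-+ f g xs))
  (solve 4 (λ a b c d → (a :+ b) :+ (c :+ d) := (a :+ c) :+ (b :+ d)) refl (f x) (g x) _ _)

Σ-0 : ∀ (xs : List A) → Σ[ x ∈ xs ] 0ℚ ≡ 0ℚ
Σ-0 []       = refl
Σ-0 (x ∷ xs) = trans (ℚP.+-identityˡ _) (Σ-0 xs)

length*≤Σ : ∀ {f : A → ℚ} c xs → (∀ {x} → x ∈ xs → c ℚ.≤ f x) → fromℕ (length xs) ℚ.* c ℚ.≤ Σ[ x ∈ xs ] f x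
length*≤Σ c []       c≤f = ℚP.≤-reflexive (ℚP.*-zeroˡ c)
length*≤Σ c (x ∷ xs) c≤f = begin
  fromℕ (suc (length xs)) ℚ.* c          ≡⟨ cong (ℚ._* c) (fromℕ-suc (length xs)) ⟩
  (1ℚ ℚ.+ fromℕ (length xs)) ℚ.* c       ≡⟨ ℚP.*-distribʳ-+ c 1ℚ (fromℕ (length xs)) ⟩
  1ℚ ℚ.* c ℚ.+ fromℕ (length xs) ℚ.* c   ≤⟨ ℚP.+-mono-≤ (ℚP.≤-trans (ℚP.≤-reflexive (ℚP.*-identityˡ c)) (c≤f (here refl)))
                                                         (length*≤Σ c xs (c≤f ∘′ there)) ⟩
  _                                      ∎
  where open ℚP.≤-Reasoning

Unique-⊆⇒↭++ : ∀ {xs ys : List A} → Unique xs → (∀ {x} → x ∈ xs → x ∈ ys) → ∃ λ zs → ys ↭ xs ++ zs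
Unique-⊆⇒↭++ {xs = []}     {ys} _              _     = ys , ↭.refl
Unique-⊆⇒↭++ {xs = x ∷ xs} {ys} (x∉xs ∷ !xs) xs⊆ys with ∈-∃++ (xs⊆ys (here refl))
... | ys₁ , ys₂ , refl with Unique-⊆⇒↭++ !xs xs⊆ys₁++ys₂
  where
  xs⊆ys₁++ys₂ : ∀ {y} → y ∈ xs → y ∈ ys₁ ++ ys₂
  xs⊆ys₁++ys₂ {y} y∈xs with ∈-++⁻ ys₁ (xs⊆ys (there y∈xs))
  ... | inj₁ y∈ys₁           = ∈-++⁺ˡ y∈ys₁
  ... | inj₂ (here refl)     = ⊥-elim (All.lookup x∉xs y∈xs refl)
  ... | inj₂ (there y∈ys₂)   = ∈-++⁺ʳ ys₁ y∈ys₂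
... | zs , ys₁++ys₂↭xs++zs = zs , ↭.trans (↭P.shift x ys₁ ys₂) (↭.prep x ys₁++ys₂↭xs++zs)

Σ-mono-⊆ : ∀ (f : A → ℚ) {xs ys} → (∀ y → 0ℚ ℚ.≤ f y) → Unique xs → (∀ {x} → x ∈ xs → x ∈ ys) →
           Σ[ x ∈ xs ] f x ℚ.≤ Σ[ y ∈ ys ] f y
Σ-mono-⊆ f {xs} {ys} 0≤f !xs xs⊆ys with Unique-⊆⇒↭++ !xs xs⊆ys
... | zs , ys↭xs++zs = begin
  Σ[ x ∈ xs ] f x                           ≤⟨ p≤p+q (Σ-nonNeg zs (λ {z} _ → 0≤f z)) ⟩
  Σ[ x ∈ xs ] f x ℚ.+ Σ[ z ∈ zs ] f z       ≡⟨ Σ-++ f xs zs ⟨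
  Σ[ x ∈ xs ++ zs ] f x                     ≡⟨ Σ-↭ f ys↭xs++zs ⟨
  Σ[ y ∈ ys ] f y                           ∎
  where open ℚP.≤-Reasoning

length-mono-⊆ : ∀ {xs ys : List A} → Unique xs → (∀ {x} → x ∈ xs → x ∈ ys) → length xs ℕ.≤ length ys
length-mono-⊆ {xs = xs} !xs xs⊆ys with Unique-⊆⇒↭++ !xs xs⊆ys
... | zs , ys↭xs++zs = subst (length xs ℕ.≤_) (sym (trans (↭P.↭-length ys↭xs++zs) (LP.length-++ xs)))
                         (ℕP.m≤m+n (length xs) (length zs))

∈-boolFilter⁻ : ∀ (p : A → Bool) {x} xs → x ∈ boolFilter p xs → x ∈ xs × p x ≡ true
∈-boolFilter⁻ p (y ∷ xs) x∈ with p y in py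
∈-boolFilter⁻ p (y ∷ xs) (here refl) | true  = here refl , py
∈-boolFilter⁻ p (y ∷ xs) (there x∈)  | true  = let x∈xs , px = ∈-boolFilter⁻ p xs x∈ in there x∈xs , px
∈-boolFilter⁻ p (y ∷ xs) x∈          | false = let x∈xs , px = ∈-boolFilter⁻ p xs x∈ in there x∈xs , px

∈-boolFilter⁺ : ∀ (p : A → Bool) {x} xs → x ∈ xs → p x ≡ true → x ∈ boolFilter p xs
∈-boolFilter⁺ p (y ∷ xs) (here refl) px rewrite px = here refl
∈-boolFilter⁺ p (y ∷ xs) (there x∈xs) px with p y
... | true  = there (∈-boolFilter⁺ p xs x∈xs px)
... | false = ∈-boolFilter⁺ p xs x∈xs px

Unique-boolFilter : ∀ (p : A → Bool) {xs} → Unique xs → Unique (boolFilter p xs)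
Unique-boolFilter p {[]}     []            = []
Unique-boolFilter p {y ∷ xs} (y∉xs ∷ !xs) with p y
... | true  = All.tabulate (λ x∈ → All.lookup y∉xs (proj₁ (∈-boolFilter⁻ p xs x∈))) ∷ Unique-boolFilter p !xs
... | false = Unique-boolFilter p !xs

Σ-boolFilter : ∀ (p : A → Bool) (f : A → ℚ) xs → (∀ x → p x ≡ false → f x ≡ 0ℚ) →
               Σ[ x ∈ boolFilter p xs ] f x ≡ Σ[ x ∈ xs ] f x
Σ-boolFilter p f []       f≡0 = refl
Σ-boolFilter p f (y ∷ xs) f≡0 with p y in py
... | true  = cong (f y ℚ.+_) (Σ-boolFilter p f xs f≡0)
... | false = sym (trans (cong (ℚ._+ Σ[ x ∈ xs ] f x) (f≡0 y py))
                         (trans (ℚP.+-identityˡ _) (sym (Σ-boolFilter p f xs f≡0))))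

boolFilter-map : ∀ (p : B → Bool) (f : A → B) xs → boolFilter p (map f xs) ≡ map f (boolFilter (λ x → p (f x)) xs)
boolFilter-map p f []       = refl
boolFilter-map p f (x ∷ xs) with p (f x)
... | true  = cong (f x ∷_) (boolFilter-map p f xs)
... | false = boolFilter-map p f xs

boolFilter-++ : ∀ (p : A → Bool) xs ys → boolFilter p (xs ++ ys) ≡ boolFilter p xs ++ boolFilter p ys
boolFilter-++ p []       ys = refl
boolFilter-++ p (x ∷ xs) ys with p x
... | true  = cong (x ∷_) (boolFilter-++ p xs ys)
... | false = boolFilter-++ p xs ys

boolFilter-concatMap : ∀ (p : B → Bool) (f : A → List B) xs →
                       boolFilter p (concatMap f xs) ≡ concatMap (λ x → boolFilter p (f x)) xs
boolFilter-concatMap p f []       = refl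
boolFilter-concatMap p f (x ∷ xs) = trans (boolFilter-++ p (f x) (concatMap f xs))
                                          (cong (boolFilter p (f x) ++_) (boolFilter-concatMap p f xs))

boolFilter-const-true : ∀ (xs : List A) → boolFilter (λ _ → true) xs ≡ xs
boolFilter-const-true []       = refl
boolFilter-const-true (x ∷ xs) = cong (x ∷_) (boolFilter-const-true xs)

any-true⁺ : ∀ (p : A → Bool) {x} xs → x ∈ xs → p x ≡ true → any p xs ≡ true
any-true⁺ p (y ∷ xs) (here refl)  px rewrite px = refl
any-true⁺ p (y ∷ xs) (there x∈xs) px rewrite any-true⁺ p xs x∈xs px = BP.∨-zeroʳ (p y)

any-true⁻ : ∀ (p : A → Bool) xs → any p xs ≡ true → ∃ λ x → x ∈ xs × p x ≡ true
any-true⁻ p (y ∷ xs) any≡true with p y in py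
... | true  = y , here refl , py
... | false = let x , x∈xs , px = any-true⁻ p xs any≡true in x , there x∈xs , px

Unique-concatMap : ∀ (key : B → A) (f : A → List B) {xs} → Unique xs → (∀ x → Unique (f x)) →
                   (∀ x {y} → y ∈ f x → key y ≡ x) → Unique (concatMap f xs)
Unique-concatMap key f {[]}     []            !f key∘f = []
Unique-concatMap key f {x ∷ xs} (x∉xs ∷ !xs) !f key∘f =
  Unique.++⁺ (!f x) (Unique-concatMap key f !xs !f key∘f) disjoint
  where
  disjoint : ∀ {y} → y ∈ f x × y ∈ concatMap f xs → ⊥
  disjoint (y∈fx , y∈concat) with find (∈-concatMap⁻ f {xs = xs} y∈concat)
  ... | x′ , x′∈xs , y∈fx′ = All.lookup x∉xs x′∈xs (trans (sym (key∘f x y∈fx)) (key∘f x′ y∈fx′))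

Σ-fromℕ : ∀ (f : A → ℕ) xs → Σ[ x ∈ xs ] fromℕ (f x) ≡ fromℕ (sum (map f xs))
Σ-fromℕ f []       = refl
Σ-fromℕ f (x ∷ xs) = trans (cong (fromℕ (f x) ℚ.+_) (Σ-fromℕ f xs)) (sym (fromℕ-+ (f x) (sum (map f xs))))

-- Partial sums of the exponential series

expTerm-nonNeg : ∀ {x} → 0ℚ ℚ.≤ x → ∀ k → 0ℚ ℚ.≤ expTerm x k
expTerm-nonNeg 0≤x zero    = 0≤1
expTerm-nonNeg 0≤x (suc k) = *-nonNeg (*-nonNeg (expTerm-nonNeg 0≤x k) 0≤x) (1/suc-nonNeg k)

expTerm-mono-≤ : ∀ {x y} → 0ℚ ℚ.≤ x → x ℚ.≤ y → ∀ k → expTerm x k ℚ.≤ expTerm y k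
expTerm-mono-≤ 0≤x x≤y zero    = ℚP.≤-refl
expTerm-mono-≤ 0≤x x≤y (suc k) = *-monoʳ-≤ (1/suc-nonNeg k)
  (*-mono-≤ (expTerm-nonNeg 0≤x k) (ℚP.≤-trans 0≤x x≤y) (expTerm-mono-≤ 0≤x x≤y k) x≤y)

expPartial-mono-≤ : ∀ {x y} → 0ℚ ℚ.≤ x → x ℚ.≤ y → ∀ N → expPartial x N ℚ.≤ expPartial y N
expPartial-mono-≤ 0≤x x≤y zero    = ℚP.≤-refl
expPartial-mono-≤ 0≤x x≤y (suc N) = ℚP.+-mono-≤ (expPartial-mono-≤ 0≤x x≤y N) (expTerm-mono-≤ 0≤x x≤y (suc N))

-- (x + y)ᵏ⁺¹ / (k + 1)! dominates the first two terms of its binomial expansion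
expTerm-+ : ∀ {x y} → 0ℚ ℚ.≤ x → 0ℚ ℚ.≤ y → ∀ k →
            expTerm x (suc k) ℚ.+ y ℚ.* expTerm x k ℚ.≤ expTerm (x ℚ.+ y) (suc k)
expTerm-+ {x} {y} 0≤x 0≤y zero = ℚP.≤-reflexive
  (solve 2 (λ x y → con 1ℚ :* x :* con 1ℚ :+ y :* con 1ℚ := con 1ℚ :* (x :+ y) :* con 1ℚ) refl x y)
expTerm-+ {x} {y} 0≤x 0≤y (suc k) = begin
  Tₖ₊₁ ℚ.* x ℚ.* c′ ℚ.+ y ℚ.* Tₖ₊₁
    ≤⟨ p≤p+q (*-nonNeg (*-nonNeg (*-nonNeg 0≤y 0≤y) (expTerm-nonNeg 0≤x k)) (1/suc-nonNeg (suc k))) ⟩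
  Tₖ₊₁ ℚ.* x ℚ.* c′ ℚ.+ y ℚ.* Tₖ₊₁ ℚ.+ y ℚ.* y ℚ.* Tₖ ℚ.* c′
    ≡⟨ cong (λ t → Tₖ₊₁ ℚ.* x ℚ.* c′ ℚ.+ y ℚ.* (Tₖ ℚ.* x ℚ.* t) ℚ.+ y ℚ.* y ℚ.* Tₖ ℚ.* c′) (1/suc[suc]*[1/suc+1] k) ⟨
  Tₖ₊₁ ℚ.* x ℚ.* c′ ℚ.+ y ℚ.* (Tₖ ℚ.* x ℚ.* (c′ ℚ.* (c ℚ.+ 1ℚ))) ℚ.+ y ℚ.* y ℚ.* Tₖ ℚ.* c′
    ≡⟨ solve 5 (λ B x y c′ c → B :* x :* c :* x :* c′ :+ y :* (B :* x :* (c′ :* (c :+ con 1ℚ))) :+ y :* y :* B :* c′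
                 := (B :* x :* c :+ y :* B) :* (x :+ y) :* c′) refl Tₖ x y c′ c ⟩
  (Tₖ₊₁ ℚ.+ y ℚ.* Tₖ) ℚ.* (x ℚ.+ y) ℚ.* c′
    ≤⟨ *-monoʳ-≤ (1/suc-nonNeg (suc k)) (*-monoʳ-≤ (+-nonNeg 0≤x 0≤y) (expTerm-+ 0≤x 0≤y k)) ⟩
  expTerm (x ℚ.+ y) (suc k) ℚ.* (x ℚ.+ y) ℚ.* c′ ∎
  where
  open ℚP.≤-Reasoning
  Tₖ₊₁ Tₖ c c′ : ℚ
  Tₖ₊₁ = expTerm x (suc k)
  Tₖ = expTerm x k
  c = 1/suc k
  c′ = 1/suc (suc k)

expPartial-+ : ∀ {x y} → 0ℚ ℚ.≤ x → 0ℚ ℚ.≤ y → ∀ N →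
               expPartial x (suc N) ℚ.+ y ℚ.* expPartial x N ℚ.≤ expPartial (x ℚ.+ y) (suc N)
expPartial-+ {x} {y} 0≤x 0≤y zero = begin
  1ℚ ℚ.+ expTerm x 1 ℚ.+ y ℚ.* 1ℚ     ≡⟨ ℚP.+-assoc 1ℚ (expTerm x 1) (y ℚ.* 1ℚ) ⟩
  1ℚ ℚ.+ (expTerm x 1 ℚ.+ y ℚ.* 1ℚ)   ≤⟨ ℚP.+-monoʳ-≤ 1ℚ (expTerm-+ 0≤x 0≤y 0) ⟩
  1ℚ ℚ.+ expTerm (x ℚ.+ y) 1          ∎
  where open ℚP.≤-Reasoning
expPartial-+ {x} {y} 0≤x 0≤y (suc N) = begin
  E (suc N) ℚ.+ T (suc (suc N)) ℚ.+ y ℚ.* (E N ℚ.+ T (suc N))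
    ≡⟨ solve 5 (λ a b y e t → a :+ b :+ y :* (e :+ t) := (a :+ y :* e) :+ (b :+ y :* t)) refl
         (E (suc N)) (T (suc (suc N))) y (E N) (T (suc N)) ⟩
  (E (suc N) ℚ.+ y ℚ.* E N) ℚ.+ (T (suc (suc N)) ℚ.+ y ℚ.* T (suc N))
    ≤⟨ ℚP.+-mono-≤ (expPartial-+ 0≤x 0≤y N) (expTerm-+ 0≤x 0≤y (suc N)) ⟩
  expPartial (x ℚ.+ y) (suc N) ℚ.+ expTerm (x ℚ.+ y) (suc (suc N)) ∎
  where
  open ℚP.≤-Reasoning
  E T : ℕ → ℚ
  E = expPartial x
  T = expTerm x

[1+y]*expPartial≤expPartial[y+x] : ∀ {x y} → 0ℚ ℚ.≤ x → 0ℚ ℚ.≤ y → ∀ N →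
                                    (1ℚ ℚ.+ y) ℚ.* expPartial x N ℚ.≤ expPartial (y ℚ.+ x) (suc N)
[1+y]*expPartial≤expPartial[y+x] {x} {y} 0≤x 0≤y N = begin
  (1ℚ ℚ.+ y) ℚ.* expPartial x N
    ≡⟨ solve 2 (λ y e → (con 1ℚ :+ y) :* e := e :+ y :* e) refl y (expPartial x N) ⟩
  expPartial x N ℚ.+ y ℚ.* expPartial x N
    ≤⟨ ℚP.+-monoˡ-≤ (y ℚ.* expPartial x N) (p≤p+q {expPartial x N} (expTerm-nonNeg 0≤x (suc N))) ⟩
  expPartial x (suc N) ℚ.+ y ℚ.* expPartial x N
    ≤⟨ expPartial-+ 0≤x 0≤y N ⟩
  expPartial (x ℚ.+ y) (suc N)
    ≡⟨ cong (λ t → expPartial t (suc N)) (ℚP.+-comm x y) ⟩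
  expPartial (y ℚ.+ x) (suc N) ∎
  where open ℚP.≤-Reasoning

∏[1+_] : List ℚ → ℚ
∏[1+ ys ] = prodℚ (map (1ℚ ℚ.+_) ys)

∏[1+]-++ : ∀ xs ys → ∏[1+ xs ++ ys ] ≡ ∏[1+ xs ] ℚ.* ∏[1+ ys ]
∏[1+]-++ xs ys = trans (cong prodℚ (LP.map-++ (1ℚ ℚ.+_) xs ys)) (prodℚ-++ (map (1ℚ ℚ.+_) xs) (map (1ℚ ℚ.+_) ys))

∏[1+y]≤expPartial[Σy] : ∀ {ys} → All (0ℚ ℚ.≤_) ys → ∏[1+ ys ] ℚ.≤ expPartial (sumℚ ys) (length ys)
∏[1+y]≤expPartial[Σy] []                      = ℚP.≤-refl
∏[1+y]≤expPartial[Σy] (_∷_ {y} {ys} 0≤y 0≤ys) = begin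
  (1ℚ ℚ.+ y) ℚ.* ∏[1+ ys ]                          ≤⟨ *-monoˡ-≤ (+-nonNeg 0≤1 0≤y) (∏[1+y]≤expPartial[Σy] 0≤ys) ⟩
  (1ℚ ℚ.+ y) ℚ.* expPartial (sumℚ ys) (length ys)   ≤⟨ [1+y]*expPartial≤expPartial[y+x] (sumℚ-nonNeg 0≤ys) 0≤y (length ys) ⟩
  expPartial (y ℚ.+ sumℚ ys) (suc (length ys))      ∎
  where open ℚP.≤-Reasoning

harmonicTail : ℕ → List ℚ
harmonicTail zero    = []
harmonicTail (suc m) = 1/suc (suc m) ∷ harmonicTail m

harmonicTail-nonNeg : ∀ m → All (0ℚ ℚ.≤_) (harmonicTail m)
harmonicTail-nonNeg zero    = []
harmonicTail-nonNeg (suc m) = 1/suc-nonNeg (suc m) ∷ harmonicTail-nonNeg m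

length-harmonicTail : ∀ m → length (harmonicTail m) ≡ m
length-harmonicTail zero    = refl
length-harmonicTail (suc m) = cong suc (length-harmonicTail m)

∏[1+harmonicTail] : ∀ m → ∏[1+ harmonicTail m ] ≡ fromℕ (suc (suc m)) ℚ.* ½
∏[1+harmonicTail] zero    = refl
∏[1+harmonicTail] (suc m) = begin
  (1ℚ ℚ.+ 1/suc (suc m)) ℚ.* ∏[1+ harmonicTail m ]
    ≡⟨ cong ((1ℚ ℚ.+ 1/suc (suc m)) ℚ.*_) (∏[1+harmonicTail] m) ⟩
  (1ℚ ℚ.+ 1/suc (suc m)) ℚ.* (fromℕ (suc (suc m)) ℚ.* ½)
    ≡⟨ ℚP.*-assoc (1ℚ ℚ.+ 1/suc (suc m)) (fromℕ (suc (suc m))) ½ ⟨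
  (1ℚ ℚ.+ 1/suc (suc m)) ℚ.* fromℕ (suc (suc m)) ℚ.* ½
    ≡⟨ cong (ℚ._* ½) ([1+1/suc]*fromℕ (suc m)) ⟩
  fromℕ (suc (suc (suc m))) ℚ.* ½ ∎
  where open ≡-Reasoning

harmonicBound : ℕ → ℚ
harmonicBound m = fromℕ 2 ℚ.+ sumℚ (harmonicTail m)

harmonicBound-pos : ∀ m → 0ℚ ℚ.< harmonicBound m
harmonicBound-pos m = ℚP.<-≤-trans (ℚP.positive⁻¹ (fromℕ 2)) (p≤p+q (sumℚ-nonNeg (harmonicTail-nonNeg m)))

-- (9/8)¹⁶ ≈ 6.59 stands in for e² ≈ 7.39
eighths : List ℚ
eighths = replicate 16 (+ 1 / 8)

13/2≤∏[1+eighths] : + 13 / 2 ℚ.≤ ∏[1+ eighths ]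
13/2≤∏[1+eighths] = toWitness {a? = + 13 / 2 ℚP.≤? ∏[1+ eighths ]} _

1+3[m+1]<13/2*[m+2]/2 : ∀ m → 1ℚ ℚ.+ fromℕ 3 ℚ.* fromℕ (suc m) ℚ.< + 13 / 2 ℚ.* (fromℕ (suc (suc m)) ℚ.* ½)
1+3[m+1]<13/2*[m+2]/2 m = begin-strict
  1ℚ ℚ.+ fromℕ 3 ℚ.* Y
    <⟨ p<p+q (ℚP.+-mono-<-≤ (ℚP.positive⁻¹ (+ 9 / 4)) (*-nonNeg (ℚP.nonNegative⁻¹ (+ 1 / 4)) (fromℕ-nonNeg (suc m)))) ⟩
  1ℚ ℚ.+ fromℕ 3 ℚ.* Y ℚ.+ (+ 9 / 4 ℚ.+ + 1 / 4 ℚ.* Y)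
    ≡⟨ solve 1 (λ y → con 1ℚ :+ con (fromℕ 3) :* y :+ (con (+ 9 / 4) :+ con (+ 1 / 4) :* y)
                   := con (+ 13 / 2) :* ((con 1ℚ :+ y) :* con ½)) refl Y ⟩
  + 13 / 2 ℚ.* ((1ℚ ℚ.+ Y) ℚ.* ½)
    ≡⟨ cong (λ t → + 13 / 2 ℚ.* (t ℚ.* ½)) (fromℕ-suc (suc m)) ⟨
  + 13 / 2 ℚ.* (fromℕ (suc (suc m)) ℚ.* ½) ∎
  where
  open ℚP.≤-Reasoning
  Y : ℚ
  Y = fromℕ (suc m)

expPartial-bound : ∀ {n m} → n ℕ.≤ 3 ℕ.* suc m → fromℕ (suc n) ℚ.< expPartial (harmonicBound m) (16 ℕ.+ m)
expPartial-bound {n} {m} n≤3[m+1] = begin-strict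
  fromℕ (suc n)
    ≤⟨ fromℕ-mono-≤ (ℕ.s≤s n≤3[m+1]) ⟩
  fromℕ (suc (3 ℕ.* suc m))
    ≡⟨ trans (fromℕ-suc (3 ℕ.* suc m)) (cong (1ℚ ℚ.+_) (fromℕ-* 3 (suc m))) ⟩
  1ℚ ℚ.+ fromℕ 3 ℚ.* fromℕ (suc m)
    <⟨ 1+3[m+1]<13/2*[m+2]/2 m ⟩
  + 13 / 2 ℚ.* (fromℕ (suc (suc m)) ℚ.* ½)
    ≤⟨ *-monoʳ-≤ (*-nonNeg (fromℕ-nonNeg (suc (suc m))) (ℚP.nonNegative⁻¹ ½)) 13/2≤∏[1+eighths] ⟩
  ∏[1+ eighths ] ℚ.* (fromℕ (suc (suc m)) ℚ.* ½)
    ≡⟨ cong (∏[1+ eighths ] ℚ.*_) (∏[1+harmonicTail] m) ⟨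
  ∏[1+ eighths ] ℚ.* ∏[1+ harmonicTail m ]
    ≡⟨ ∏[1+]-++ eighths (harmonicTail m) ⟨
  ∏[1+ ys ]
    ≤⟨ ∏[1+y]≤expPartial[Σy] (AllP.++⁺ (AllP.replicate⁺ 16 (ℚP.nonNegative⁻¹ (+ 1 / 8))) (harmonicTail-nonNeg m)) ⟩
  expPartial (sumℚ ys) (length ys)
    ≡⟨ cong₂ expPartial (sumℚ-++ eighths (harmonicTail m)) (cong (16 ℕ.+_) (length-harmonicTail m)) ⟩
  expPartial (harmonicBound m) (16 ℕ.+ m) ∎
  where
  open ℚP.≤-Reasoning
  ys : List ℚ
  ys = eighths ++ harmonicTail m

-- n < eᴸ gives ln n < L, so P ≤ c / L < c / ln n.
LtMulInvLn-intro : ∀ {P c L n N} → 0ℚ ℚ.< L → P ℚ.≤ c ℚ.* inv L → fromℕ n ℚ.< expPartial L N → LtMulInvLn P c n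
LtMulInvLn-intro {P} {c} {L} {n} {N} 0<L P≤c/L n<eᴸ with 0ℚ ℚP.<? P
... | no  P≯0 = inj₁ (ℚP.≮⇒≥ P≯0)
... | yes P>0 = inj₂ (P>0 , N , ℚP.<-≤-trans n<eᴸ (expPartial-mono-≤ 0≤L L≤c/P N))
  where
  instance
    P≢0 : ℚ.NonZero P
    P≢0 = >-nonZero P>0
  0≤L : 0ℚ ℚ.≤ L
  0≤L = ℚP.<⇒≤ 0<L
  L≤c/P : L ℚ.≤ c ÷ P
  L≤c/P = begin
    L                                  ≡⟨ trans (cong (L ℚ.*_) (ℚP.*-inverseʳ P)) (ℚP.*-identityʳ L) ⟨
    L ℚ.* (P ℚ.* 1/ P)                 ≤⟨ *-monoˡ-≤ 0≤L (*-monoʳ-≤ (1/-nonNeg P>0) P≤c/L) ⟩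
    L ℚ.* (c ℚ.* inv L ℚ.* 1/ P)       ≡⟨ solve 4 (λ L c i r → L :* (c :* i :* r) := (i :* L) :* (c :* r))
                                                 refl L c (inv L) (1/ P) ⟩
    (inv L ℚ.* L) ℚ.* (c ℚ.* 1/ P)     ≡⟨ cong (ℚ._* (c ℚ.* 1/ P)) (inv*p≡1 (≢-sym (ℚP.<⇒≢ 0<L))) ⟩
    1ℚ ℚ.* (c ℚ.* 1/ P)                ≡⟨ ℚP.*-identityˡ (c ℚ.* 1/ P) ⟩
    c ÷ P                              ∎
    where open ℚP.≤-Reasoning

true≢false : true ≢ false
true≢false ()

does-true⁻ : ∀ {P : Set} (P? : Dec P) → does P? ≡ true → P
does-true⁻ (yes p) _ = p

==V⇒≡ : ∀ {v w} → (v ==V w) ≡ true → v ≡ w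
==V⇒≡ {x , y , z} {x′ , y′ , z′} eq with x ℤ.≟ x′ | y ℤ.≟ y′ | z ℤ.≟ z′ | eq
... | yes refl | yes refl | yes refl | _ = refl
... | no _     | _        | _        | ()
... | yes _    | no _     | _        | ()
... | yes _    | yes _    | no _     | ()

==V-refl : ∀ v → (v ==V v) ≡ true
==V-refl (x , y , z) with x ℤ.≟ x | y ℤ.≟ y | z ℤ.≟ z
... | yes _   | yes _   | yes _   = refl
... | no x≢x  | _       | _       = ⊥-elim (x≢x refl)
... | yes _   | no y≢y  | _       = ⊥-elim (y≢y refl)
... | yes _   | yes _   | no z≢z  = ⊥-elim (z≢z refl)

≢⇒==V-false : ∀ {v w} → v ≢ w → (v ==V w) ≡ false
≢⇒==V-false {v} {w} v≢w with v ==V w in eq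
... | true  = ⊥-elim (v≢w (==V⇒≡ eq))
... | false = refl

==V-false⇒≢ : ∀ {v w} → (v ==V w) ≡ false → v ≢ w
==V-false⇒≢ {v} v==w≡false refl with () ← trans (sym v==w≡false) (==V-refl v)

norm₁ : Vtx → ℕ
norm₁ (x , y , z) = ∣ x ∣ ℕ.+ ∣ y ∣ ℕ.+ ∣ z ∣

line : ℕ → ℤ → ℤ → List Vtx
line n x y = map (λ z → (x , y , z)) (range n)

plane : ℕ → ℤ → List Vtx
plane n x = concatMap (line n x) (range n)

cube : ℕ → List Vtx
cube n = concatMap (plane n) (range n)

+i-+n∈range : ∀ {n i} → i ≤ 2 ℕ.* n → + i ℤ.- + n ∈ range n
+i-+n∈range i≤2n = ∈-map⁺ _ (∈-upTo⁺ (ℕ.s≤s i≤2n))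

∈-range⁺ : ∀ {n c} → ∣ c ∣ ≤ n → c ∈ range n
∈-range⁺ {n} {+ m} m≤n = subst (_∈ range n) eq
  (+i-+n∈range {n} (ℕP.≤-trans (ℕP.+-monoˡ-≤ n m≤n) (ℕP.≤-reflexive (n+n≡2n n))))
  where
  n+n≡2n : ∀ n → n ℕ.+ n ≡ 2 ℕ.* n
  n+n≡2n = ℕ-Solver.solve-∀
  [a+b]-b≡a : ∀ a b → a ℤ.+ b ℤ.- b ≡ a
  [a+b]-b≡a = ℤ-Solver.solve-∀
  eq : + (m ℕ.+ n) ℤ.- + n ≡ + m
  eq = trans (cong (ℤ._- + n) (ℤP.pos-+ m n)) ([a+b]-b≡a (+ m) (+ n))
∈-range⁺ {n} { -[1+ m ]} m<n = subst (_∈ range n) eq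
  (+i-+n∈range {n} (ℕP.≤-trans (ℕP.m∸n≤m n (suc m)) (ℕP.m≤m+n n _)))
  where
  eq : + (n ℕ.∸ suc m) ℤ.- + n ≡ -[1+ m ]
  eq = trans (cong (ℤ._- + n) (trans (sym (ℤP.⊖-≥ m<n)) (sym (ℤP.m-n≡m⊖n n (suc m))))) ([a-b]-a≡-b (+ n) (+ suc m))
    where
    [a-b]-a≡-b : ∀ a b → a ℤ.- b ℤ.- a ≡ ℤ.- b
    [a-b]-a≡-b = ℤ-Solver.solve-∀

∈-cube⁺ : ∀ {n x y z} → x ∈ range n → y ∈ range n → z ∈ range n → (x , y , z) ∈ cube n
∈-cube⁺ {n} {x} {y} {z} x∈ y∈ z∈ =
  ∈-concatMap⁺ (plane n) (Any.map (λ { refl → ∈-concatMap⁺ (line n x) (Any.map (λ { refl → ∈-map⁺ _ z∈ }) y∈) }) x∈)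

∈V⁺ : ∀ {n} v → norm₁ v ≡ n → v ∈ V n
∈V⁺ {n} (x , y , z) ∣v∣≡n = ∈-boolFilter⁺ _ (cube n)
  (∈-cube⁺ {n} (∈-range⁺ ∣x∣≤n) (∈-range⁺ ∣y∣≤n) (∈-range⁺ ∣z∣≤n)) (dec-true (norm₁ (x , y , z) ℕ.≟ n) ∣v∣≡n)
  where
  ∣x∣≤n : ∣ x ∣ ≤ n
  ∣x∣≤n = subst (∣ x ∣ ≤_) ∣v∣≡n (ℕP.≤-trans (ℕP.m≤m+n ∣ x ∣ ∣ y ∣) (ℕP.m≤m+n _ ∣ z ∣))
  ∣y∣≤n : ∣ y ∣ ≤ n
  ∣y∣≤n = subst (∣ y ∣ ≤_) ∣v∣≡n (ℕP.≤-trans (ℕP.m≤n+m ∣ y ∣ ∣ x ∣) (ℕP.m≤m+n _ ∣ z ∣))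
  ∣z∣≤n : ∣ z ∣ ≤ n
  ∣z∣≤n = subst (∣ z ∣ ≤_) ∣v∣≡n (ℕP.m≤n+m ∣ z ∣ _)

∈V⁻ : ∀ {n v} → v ∈ V n → norm₁ v ≡ n
∈V⁻ {n} {x , y , z} v∈V = does-true⁻ (norm₁ (x , y , z) ℕ.≟ n) (proj₂ (∈-boolFilter⁻ _ (cube n) v∈V))

Unique-range : ∀ n → Unique (range n)
Unique-range n = Unique.map⁺ offset-injective (Unique.upTo⁺ (suc (2 ℕ.* n)))
  where
  [a-b]+b≡a : ∀ a b → a ℤ.- b ℤ.+ b ≡ a
  [a-b]+b≡a = ℤ-Solver.solve-∀
  offset-injective : ∀ {i j} → + i ℤ.- + n ≡ + j ℤ.- + n → i ≡ j
  offset-injective {i} {j} eq = ℤP.+-injective (begin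
    + i                  ≡⟨ [a-b]+b≡a (+ i) (+ n) ⟨
    + i ℤ.- + n ℤ.+ + n  ≡⟨ cong (ℤ._+ + n) eq ⟩
    + j ℤ.- + n ℤ.+ + n  ≡⟨ [a-b]+b≡a (+ j) (+ n) ⟩
    + j                  ∎)
    where open ≡-Reasoning

Unique-V : ∀ n → Unique (V n)
Unique-V n = Unique-boolFilter _ (Unique-concatMap proj₁ (plane n) (Unique-range n) Unique-plane ∈-plane⇒proj₁)
  where
  ∈-line⇒proj₁,₂ : ∀ {x y v} → v ∈ line n x y → proj₁ v ≡ x × proj₁ (proj₂ v) ≡ y
  ∈-line⇒proj₁,₂ {x} {y} v∈ with ∈-map⁻ (λ z → (x , y , z)) v∈
  ... | _ , _ , refl = refl , refl
  ∈-plane⇒proj₁ : ∀ x {v} → v ∈ plane n x → proj₁ v ≡ x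
  ∈-plane⇒proj₁ x v∈ with find (∈-concatMap⁻ (line n x) {xs = range n} v∈)
  ... | _ , _ , v∈line = proj₁ (∈-line⇒proj₁,₂ v∈line)
  Unique-plane : ∀ x → Unique (plane n x)
  Unique-plane x = Unique-concatMap (proj₁ ∘ proj₂) (line n x) (Unique-range n)
    (λ y → Unique.map⁺ (cong (proj₂ ∘ proj₂)) (Unique-range n))
    (λ y v∈ → proj₂ (∈-line⇒proj₁,₂ v∈))

close-sym : ∀ a b → close a b ≡ close b a
close-sym a b = cong (λ d → does (d ℕ.≤? 1)) (ℤP.∣i-j∣≡∣j-i∣ a b)

close-refl : ∀ a → close a a ≡ true
close-refl a = dec-true (∣ a ℤ.- a ∣ ℕ.≤? 1) (subst (ℕ._≤ 1) (sym (cong ∣_∣ (ℤP.+-inverseʳ a))) ℕ.z≤n)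

close-◃-suc : ∀ s m → close (s ◃ suc m) (s ◃ m) ≡ true
close-◃-suc s m = dec-true (∣ (s ◃ suc m) ℤ.- (s ◃ m) ∣ ℕ.≤? 1) (ℕP.≤-reflexive (begin
  ∣ (s ◃ suc m) ℤ.- (s ◃ m) ∣              ≡⟨ cong (λ i → ∣ i ℤ.- (s ◃ m) ∣) (ℤP.◃-distrib-+ s 1 m) ⟩
  ∣ (s ◃ 1) ℤ.+ (s ◃ m) ℤ.- (s ◃ m) ∣      ≡⟨ cong ∣_∣ ([a+b]-b≡a (s ◃ 1) (s ◃ m)) ⟩
  ∣ s ◃ 1 ∣                          ≡⟨ ℤP.abs-◃ s 1 ⟩
  1                                  ∎))
  where
  open ≡-Reasoning
  [a+b]-b≡a : ∀ a b → a ℤ.+ b ℤ.- b ≡ a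
  [a+b]-b≡a = ℤ-Solver.solve-∀

close⁻ : ∀ a b → close a b ≡ true → ∣ a ℤ.- b ∣ ≤ 1
close⁻ a b = does-true⁻ (∣ a ℤ.- b ∣ ℕ.≤? 1)

adj⁺ : ∀ {x y z x′ y′ z′} → (x , y , z) ≢ (x′ , y′ , z′) →
       close x x′ ≡ true → close y y′ ≡ true → close z z′ ≡ true → adj (x , y , z) (x′ , y′ , z′) ≡ true
adj⁺ v≢w cx cy cz rewrite ≢⇒==V-false v≢w | cx | cy | cz = refl

adj⁻ : ∀ {x y z x′ y′ z′} → adj (x , y , z) (x′ , y′ , z′) ≡ true →
       close x x′ ≡ true × close y y′ ≡ true × close z z′ ≡ true
adj⁻ {x} {y} {z} {x′} {y′} {z′} adj≡true
  with (x , y , z) ==V (x′ , y′ , z′) | close x x′ | close y y′ | close z z′ | adj≡true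
... | false | true | true | true | _ = refl , refl , refl

∈b⁺ : ∀ {w} L → w ∈ L → (w ∈b L) ≡ true
∈b⁺ {w} L w∈L = any-true⁺ (w ==V_) L w∈L (==V-refl w)

∈b⁻ : ∀ {w} L → (w ∈b L) ≡ true → w ∈ L
∈b⁻ {w} L w∈bL with any-true⁻ (w ==V_) L w∈bL
... | x , x∈L , w==x = subst (_∈ L) (sym (==V⇒≡ w==x)) x∈L

ball-suc⁺ : ∀ {n} j u {x w} → w ∈ V n → x ∈ ball n j u → adj x w ≡ true → w ∈ ball n (suc j) u
ball-suc⁺ {n} j u {x} {w} w∈V x∈ball x~w = ∈-boolFilter⁺ _ (V n) w∈V
  (any-true⁺ (λ y → (y ==V w) ∨ adj y w) (ball n j u) x∈ball (trans (cong ((x ==V w) ∨_) x~w) (BP.∨-zeroʳ (x ==V w))))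

ball-zero⁻ : ∀ {n u w} → w ∈ ball n 0 u → w ≡ u
ball-zero⁻ (here w≡u) = w≡u

ball-one⁻ : ∀ {n u w} → w ∈ ball n 1 u → (u ==V w) ∨ adj u w ≡ true
ball-one⁻ {n} {u} {w} w∈ball with any-true⁻ (λ x → (x ==V w) ∨ adj x w) (u ∷ []) (proj₂ (∈-boolFilter⁻ _ (V n) w∈ball))
... | _ , here refl , u~w = u~w

searchDist-spec : ∀ n k fuel u w → searchDist n k fuel u w ≡ 0 ⊎ (w ∈b ball n (searchDist n k fuel u w) u) ≡ true
searchDist-spec n k zero u w with w ∈b ball n k u in w∈b
... | true  = inj₂ w∈b
... | false = inj₁ refl
searchDist-spec n k (suc fuel) u w with w ∈b ball n k u in w∈b
... | true  = inj₂ w∈b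
... | false = searchDist-spec n (suc k) fuel u w

searchDist-least : ∀ n k fuel u w j → (w ∈b ball n j u) ≡ true → k ≤ j → j ≤ k ℕ.+ fuel →
                   searchDist n k fuel u w ≤ j × (w ∈b ball n (searchDist n k fuel u w) u) ≡ true
searchDist-least n k zero u w j w∈bj k≤j j≤k+0 with w ∈b ball n k u in w∈bk
... | true = k≤j , w∈bk
... | false with refl ← ℕP.≤-antisym k≤j (subst (j ≤_) (ℕP.+-identityʳ k) j≤k+0) =
  ⊥-elim (true≢false (trans (sym w∈bj) w∈bk))
searchDist-least n k (suc fuel) u w j w∈bj k≤j j≤k+fuel with w ∈b ball n k u in w∈bk
... | true = k≤j , w∈bk
... | false with k ℕ.≟ j
...   | yes refl = ⊥-elim (true≢false (trans (sym w∈bj) w∈bk))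
...   | no k≢j   = searchDist-least n (suc k) fuel u w j w∈bj (ℕP.≤∧≢⇒< k≤j k≢j) (subst (j ≤_) (ℕP.+-suc k fuel) j≤k+fuel)

dist≡1⇒adj : ∀ {n a b} → a ≢ b → dist n a b ≡ 1 → adj a b ≡ true
dist≡1⇒adj {n} {a} {b} a≢b d≡1 with searchDist-spec n 0 (length (V n)) a b
... | inj₁ d≡0  = ⊥-elim (ℕP.1+n≢0 (trans (sym d≡1) d≡0))
... | inj₂ b∈bd with ball-one⁻ {n} {a} (∈b⁻ {b} (ball n 1 a) (subst (λ d → (b ∈b ball n d a) ≡ true) d≡1 b∈bd))
...   | a=b∨a~b rewrite ≢⇒==V-false a≢b = a=b∨a~b

dist-bounds : ∀ {n a w j} → w ≢ a → w ∈ ball n j a → j ≤ length (V n) → 1 ≤ dist n a w × dist n a w ≤ j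
dist-bounds {n} {a} {w} {j} w≢a w∈ball j≤|V|
  with dist n a w | searchDist-least n 0 (length (V n)) a w j (∈b⁺ (ball n j a) w∈ball) ℕ.z≤n j≤|V|
... | zero  | _ , w∈b0 = ⊥-elim (w≢a (ball-zero⁻ {n} (∈b⁻ {w} (ball n 0 a) w∈b0)))
... | suc d | d≤j , _  = ℕ.s≤s ℕ.z≤n , d≤j

-- Every vertex has many vertices close by

data Axis : Set where
  x-axis y-axis z-axis : Axis

place : Axis → ℤ → ℤ → ℤ → Vtx
place x-axis p q s = (p , q , s)
place y-axis p q s = (q , p , s)
place z-axis p q s = (q , s , p)

norm₁-place : ∀ ax p q s → norm₁ (place ax p q s) ≡ ∣ p ∣ ℕ.+ ∣ q ∣ ℕ.+ ∣ s ∣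
norm₁-place x-axis p q s = refl
norm₁-place y-axis p q s = cong (ℕ._+ ∣ s ∣) (ℕP.+-comm ∣ q ∣ ∣ p ∣)
norm₁-place z-axis p q s = rotate (∣ p ∣) (∣ q ∣) (∣ s ∣)
  where
  rotate : ∀ a b c → b ℕ.+ c ℕ.+ a ≡ a ℕ.+ b ℕ.+ c
  rotate = ℕ-Solver.solve-∀

place-injective : ∀ ax {p q s p′ q′ s′} → place ax p q s ≡ place ax p′ q′ s′ → p ≡ p′ × q ≡ q′ × s ≡ s′
place-injective x-axis refl = refl , refl , refl
place-injective y-axis refl = refl , refl , refl
place-injective z-axis refl = refl , refl , refl

adj-place : ∀ ax {p q s p′ q′ s′} → p ≢ p′ → close p p′ ≡ true → close q q′ ≡ true → close s s′ ≡ true →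
            adj (place ax p q s) (place ax p′ q′ s′) ≡ true
adj-place x-axis {p} {q} {s} {p′} {q′} {s′} p≢p′ cp cq cs =
  adj⁺ {p} {q} {s} {p′} {q′} {s′} (λ v≡w → p≢p′ (cong proj₁ v≡w)) cp cq cs
adj-place y-axis {p} {q} {s} {p′} {q′} {s′} p≢p′ cp cq cs =
  adj⁺ {q} {p} {s} {q′} {p′} {s′} (λ v≡w → p≢p′ (cong (proj₁ ∘ proj₂) v≡w)) cq cp cs
adj-place z-axis {p} {q} {s} {p′} {q′} {s′} p≢p′ cp cq cs =
  adj⁺ {q} {s} {p} {q′} {s′} {p′} (λ v≡w → p≢p′ (cong (proj₂ ∘ proj₂) v≡w)) cq cs cp

record LargeCoordinate (a : Vtx) (r : ℕ) : Set where
  field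
    axis    : Axis
    p q s   : ℤ
    a≡place : a ≡ place axis p q s
    r≤∣p∣   : r ≤ ∣ p ∣

pigeonhole : ∀ {m} a → 3 ℕ.* m < norm₁ a → LargeCoordinate a (suc m)
pigeonhole {m} (x , y , z) 3m<∣a∣ with suc m ℕ.≤? ∣ x ∣ | suc m ℕ.≤? ∣ y ∣ | suc m ℕ.≤? ∣ z ∣
... | yes m<∣x∣ | _         | _         = record { axis = x-axis ; p = x ; q = y ; s = z ; a≡place = refl ; r≤∣p∣ = m<∣x∣ }
... | no _      | yes m<∣y∣ | _         = record { axis = y-axis ; p = y ; q = x ; s = z ; a≡place = refl ; r≤∣p∣ = m<∣y∣ }
... | no _      | no _      | yes m<∣z∣ = record { axis = z-axis ; p = z ; q = x ; s = y ; a≡place = refl ; r≤∣p∣ = m<∣z∣ }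
... | no m≮∣x∣  | no m≮∣y∣  | no m≮∣z∣  = ⊥-elim (ℕP.<⇒≱ 3m<∣a∣ (begin
  ∣ x ∣ ℕ.+ ∣ y ∣ ℕ.+ ∣ z ∣  ≤⟨ ℕP.+-mono-≤ (ℕP.+-mono-≤ (≤m m≮∣x∣) (≤m m≮∣y∣)) (≤m m≮∣z∣) ⟩
  m ℕ.+ m ℕ.+ m              ≡⟨ m+m+m≡3m m ⟩
  3 ℕ.* m                    ∎))
  where
  open ℕP.≤-Reasoning
  ≤m : ∀ {k} → ¬ suc m ≤ k → k ≤ m
  ≤m m≮k = ℕP.≤-pred (ℕP.≰⇒> m≮k)
  m+m+m≡3m : ∀ m → m ℕ.+ m ℕ.+ m ≡ 3 ℕ.* m
  m+m+m≡3m = ℕ-Solver.solve-∀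

close-◃-suc′ : ∀ s m → close (s ◃ m) (s ◃ suc m) ≡ true
close-◃-suc′ s m = trans (close-sym (s ◃ m) (s ◃ suc m)) (close-◃-suc s m)

◃-suc-≢ : ∀ s m → s ◃ suc m ≢ s ◃ m
◃-suc-≢ s m eq = ℕP.1+n≢n (trans (sym (ℤP.abs-◃ s (suc m))) (trans (cong ∣_∣ eq) (ℤP.abs-◃ s m)))

module Staircase {n r a} (a∈V : a ∈ V n) (large : LargeCoordinate a r) where
  open LargeCoordinate large

  P Q S : ℕ
  P = ∣ p ∣
  Q = ∣ q ∣
  S = ∣ s ∣

  -- j unit steps away from a: each lowers ∣p∣, i of them raise ∣q∣ and the others ∣s∣
  stair : ℕ → ℕ → Vtx
  stair j i = place axis (sign p ◃ (P ℕ.∸ j)) (sign q ◃ (Q ℕ.+ i)) (sign s ◃ (S ℕ.+ (j ℕ.∸ i)))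

  stair-0-0 : stair 0 0 ≡ a
  stair-0-0 = trans (cong₃ (place axis) (ℤP.◃-inverse p) (◃-+0 q) (◃-+0 s)) (sym a≡place)
    where
    cong₃ : ∀ f {x x′ y y′ z z′} → x ≡ x′ → y ≡ y′ → z ≡ z′ → f x y z ≡ f x′ y′ z′
    cong₃ f refl refl refl = refl
    ◃-+0 : ∀ i → sign i ◃ (∣ i ∣ ℕ.+ 0) ≡ i
    ◃-+0 i = trans (cong (sign i ◃_) (ℕP.+-identityʳ ∣ i ∣)) (ℤP.◃-inverse i)

  norm₁-stair : ∀ {j i} → i ≤ j → j ≤ P → norm₁ (stair j i) ≡ n
  norm₁-stair {j} {i} i≤j j≤P = begin
    norm₁ (stair j i)                                        ≡⟨ norm₁-place axis _ _ _ ⟩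
    ∣ sign p ◃ (P ℕ.∸ j) ∣ ℕ.+ ∣ sign q ◃ (Q ℕ.+ i) ∣ ℕ.+ ∣ sign s ◃ (S ℕ.+ (j ℕ.∸ i)) ∣
                                                             ≡⟨ cong₂ ℕ._+_ (cong₂ ℕ._+_ (ℤP.abs-◃ (sign p) (P ℕ.∸ j)) (ℤP.abs-◃ (sign q) (Q ℕ.+ i)))
                                                                            (ℤP.abs-◃ (sign s) (S ℕ.+ (j ℕ.∸ i))) ⟩
    (P ℕ.∸ j) ℕ.+ (Q ℕ.+ i) ℕ.+ (S ℕ.+ (j ℕ.∸ i))            ≡⟨ regroup (P ℕ.∸ j) Q S i (j ℕ.∸ i) ⟩
    (P ℕ.∸ j) ℕ.+ (i ℕ.+ (j ℕ.∸ i)) ℕ.+ Q ℕ.+ S              ≡⟨ cong (λ k → (P ℕ.∸ j) ℕ.+ k ℕ.+ Q ℕ.+ S) (ℕP.m+[n∸m]≡n i≤j) ⟩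
    (P ℕ.∸ j) ℕ.+ j ℕ.+ Q ℕ.+ S                              ≡⟨ cong (λ k → k ℕ.+ Q ℕ.+ S) (ℕP.m∸n+n≡m j≤P) ⟩
    P ℕ.+ Q ℕ.+ S                                            ≡⟨ norm₁-place axis p q s ⟨
    norm₁ (place axis p q s)                                 ≡⟨ cong norm₁ a≡place ⟨
    norm₁ a                                                  ≡⟨ ∈V⁻ a∈V ⟩
    n                                                        ∎
    where
    open ≡-Reasoning
    regroup : ∀ a b c d e → a ℕ.+ (b ℕ.+ d) ℕ.+ (c ℕ.+ e) ≡ a ℕ.+ (d ℕ.+ e) ℕ.+ b ℕ.+ c
    regroup = ℕ-Solver.solve-∀

  stair-∈V : ∀ {j i} → i ≤ j → j ≤ P → stair j i ∈ V n
  stair-∈V i≤j j≤P = ∈V⁺ _ (norm₁-stair i≤j j≤P)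

  stair-injectiveʲ : ∀ {j i j′ i′} → j ≤ P → j′ ≤ P → stair j i ≡ stair j′ i′ → j ≡ j′
  stair-injectiveʲ j≤P j′≤P eq = ℕP.∸-cancelˡ-≡ j≤P j′≤P (ℤP.abs-cong (proj₁ (place-injective axis eq)))

  stair-injectiveⁱ : ∀ {j i i′} → stair j i ≡ stair j i′ → i ≡ i′
  stair-injectiveⁱ eq = ℕP.+-cancelˡ-≡ Q _ _ (ℤP.abs-cong (proj₁ (proj₂ (place-injective axis eq))))

  stair≢a : ∀ {j i} → 1 ≤ j → j ≤ P → stair j i ≢ a
  stair≢a {j} 1≤j j≤P eq = ℕP.<-irrefl P∸j≡P (ℕP.∸-monoʳ-< {P} {j} {0} 1≤j j≤P)
    where
    P∸j≡P : P ℕ.∸ j ≡ P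
    P∸j≡P = trans (sym (ℤP.abs-◃ (sign p) (P ℕ.∸ j))) (cong ∣_∣ (proj₁ (place-injective axis (trans eq a≡place))))

  stair-adjʲ : ∀ {j i} → i ≤ j → suc j ≤ P → adj (stair j i) (stair (suc j) i) ≡ true
  stair-adjʲ {j} {i} i≤j j<P rewrite ℕP.+-∸-assoc 1 j<P | ℕP.+-∸-assoc 1 i≤j | ℕP.+-suc S (j ℕ.∸ i) =
    adj-place axis (◃-suc-≢ (sign p) (P ℕ.∸ suc j)) (close-◃-suc (sign p) (P ℕ.∸ suc j))
                   (close-refl (sign q ◃ (Q ℕ.+ i))) (close-◃-suc′ (sign s) (S ℕ.+ (j ℕ.∸ i)))

  stair-adjⁱ : ∀ {j} → suc j ≤ P → adj (stair j j) (stair (suc j) (suc j)) ≡ true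
  stair-adjⁱ {j} j<P rewrite ℕP.+-∸-assoc 1 j<P | ℕP.+-suc Q j =
    adj-place axis (◃-suc-≢ (sign p) (P ℕ.∸ suc j)) (close-◃-suc (sign p) (P ℕ.∸ suc j))
                   (close-◃-suc′ (sign q) (Q ℕ.+ j)) (close-refl (sign s ◃ (S ℕ.+ (j ℕ.∸ j))))

  stair-∈-ball : ∀ j i → i ≤ j → j ≤ P → stair j i ∈ ball n j a
  stair-∈-ball zero    zero    _   _   = subst (_∈ ball n 0 a) (sym stair-0-0) (here refl)
  stair-∈-ball (suc j) i       i≤1+j j<P with ℕP.m≤n⇒m<n∨m≡n i≤1+j
  ... | inj₁ i<1+j = ball-suc⁺ j a (stair-∈V i≤1+j j<P)
                       (stair-∈-ball j i (ℕP.≤-pred i<1+j) (ℕP.<⇒≤ j<P)) (stair-adjʲ (ℕP.≤-pred i<1+j) j<P)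
  ... | inj₂ refl  = ball-suc⁺ j a (stair-∈V i≤1+j j<P) (stair-∈-ball j j ℕP.≤-refl (ℕP.<⇒≤ j<P)) (stair-adjⁱ j<P)

  level : ℕ → List Vtx
  level j = map (stair j) (upTo (suc j))

  staircase : ℕ → List Vtx
  staircase zero    = []
  staircase (suc j) = level (suc j) ++ staircase j

  record OnStaircase (k : ℕ) (v : Vtx) : Set where
    constructor onStair
    field
      j i  : ℕ
      i≤j  : i ≤ j
      1≤j  : 1 ≤ j
      j≤k  : j ≤ k
      v≡   : v ≡ stair j i

  ∈-level⁻ : ∀ {j v} → v ∈ level j → ∃ λ i → i ≤ j × v ≡ stair j i
  ∈-level⁻ {j} v∈ with ∈-map⁻ (stair j) v∈
  ... | i , i∈ , v≡ = i , ℕP.≤-pred (∈-upTo⁻ i∈) , v≡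

  ∈-staircase⁻ : ∀ k {v} → v ∈ staircase k → OnStaircase k v
  ∈-staircase⁻ (suc k) v∈ with ∈-++⁻ (level (suc k)) v∈
  ... | inj₁ v∈level = let i , i≤j , v≡ = ∈-level⁻ v∈level in onStair (suc k) i i≤j (ℕ.s≤s ℕ.z≤n) ℕP.≤-refl v≡
  ... | inj₂ v∈rest with ∈-staircase⁻ k v∈rest
  ...   | onStair j i i≤j 1≤j j≤k v≡ = onStair j i i≤j 1≤j (ℕP.m≤n⇒m≤1+n j≤k) v≡

  Unique-staircase : ∀ k → k ≤ P → Unique (staircase k)
  Unique-staircase zero    _   = []
  Unique-staircase (suc k) k<P = Unique.++⁺ (Unique.map⁺ stair-injectiveⁱ (Unique.upTo⁺ (suc (suc k))))
                                             (Unique-staircase k (ℕP.<⇒≤ k<P)) disjoint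
    where
    disjoint : ∀ {v} → v ∈ level (suc k) × v ∈ staircase k → ⊥
    disjoint (v∈level , v∈rest) with ∈-level⁻ v∈level | ∈-staircase⁻ k v∈rest
    ... | _ , _ , refl | onStair _ _ _ _ j≤k v≡ =
      ℕP.<-irrefl (sym (stair-injectiveʲ k<P (ℕP.≤-trans (ℕP.m≤n⇒m≤1+n j≤k) k<P) v≡)) (ℕ.s≤s j≤k)

  length-staircase : ∀ k → k ≤ length (staircase k)
  length-staircase zero    = ℕ.z≤n
  length-staircase (suc k) = begin
    suc k                                        ≤⟨ ℕP.n≤1+n (suc k) ⟩
    suc (suc k)                                  ≡⟨ trans (LP.length-map (stair (suc k)) (upTo (suc (suc k)))) (LP.length-upTo (suc (suc k))) ⟨
    length (level (suc k))                       ≤⟨ ℕP.m≤m+n _ _ ⟩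
    length (level (suc k)) ℕ.+ length (staircase k)  ≡⟨ LP.length-++ (level (suc k)) ⟨
    length (staircase (suc k))                   ∎
    where open ℕP.≤-Reasoning

  staircase-⊆-others : ∀ {k v} → k ≤ r → v ∈ staircase k → v ∈ others n a
  staircase-⊆-others {k} k≤r v∈ with ∈-staircase⁻ k v∈
  ... | onStair j i i≤j 1≤j j≤k refl = ∈-boolFilter⁺ _ (V n) (stair-∈V i≤j j≤P)
          (cong not (≢⇒==V-false (λ a≡stair → stair≢a 1≤j j≤P (sym a≡stair))))
    where
    j≤P : j ≤ P
    j≤P = ℕP.≤-trans j≤k (ℕP.≤-trans k≤r r≤∣p∣)

  r≤∣V∣ : r ≤ length (V n)
  r≤∣V∣ = ℕP.≤-trans (length-staircase r) (length-mono-⊆ (Unique-staircase r r≤∣p∣)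
            (λ v∈ → proj₁ (∈-boolFilter⁻ _ (V n) (staircase-⊆-others ℕP.≤-refl v∈))))

  Σ-level-≥ : ∀ {j} → 1 ≤ j → j ≤ r → fromℕ (suc j) ℚ.* invSq j ℚ.≤ Σ[ w ∈ level j ] invSq (dist n a w)
  Σ-level-≥ {j} 1≤j j≤r = subst (λ k → fromℕ k ℚ.* invSq j ℚ.≤ Σ[ w ∈ level j ] invSq (dist n a w))
    (trans (LP.length-map (stair j) (upTo (suc j))) (LP.length-upTo (suc j)))
    (length*≤Σ (invSq j) (level j) invSq-j≤)
    where
    j≤P : j ≤ P
    j≤P = ℕP.≤-trans j≤r r≤∣p∣
    invSq-j≤ : ∀ {w} → w ∈ level j → invSq j ℚ.≤ invSq (dist n a w)
    invSq-j≤ w∈ with ∈-level⁻ w∈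
    ... | i , i≤j , refl with dist-bounds (stair≢a 1≤j j≤P) (stair-∈-ball j i i≤j j≤P) (ℕP.≤-trans j≤r r≤∣V∣)
    ...   | 1≤d , d≤j = invSq-antimono-≤ 1≤d d≤j

  Σ-staircase-≥ : ∀ m → suc m ≤ r → harmonicBound m ℚ.≤ Σ[ w ∈ staircase (suc m) ] invSq (dist n a w)
  Σ-staircase-≥ zero    1≤r = Σ-level-≥ ℕP.≤-refl 1≤r
  Σ-staircase-≥ (suc m) m<r = begin
    fromℕ 2 ℚ.+ (1/suc (suc m) ℚ.+ sumℚ (harmonicTail m))
      ≡⟨ solve 3 (λ a b c → a :+ (b :+ c) := b :+ (a :+ c)) refl (fromℕ 2) (1/suc (suc m)) (sumℚ (harmonicTail m)) ⟩
    1/suc (suc m) ℚ.+ (fromℕ 2 ℚ.+ sumℚ (harmonicTail m))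
      ≤⟨ ℚP.+-mono-≤ (ℚP.≤-trans (1/suc≤fromℕ*invSq (suc m)) (Σ-level-≥ (ℕ.s≤s ℕ.z≤n) m<r)) (Σ-staircase-≥ m (ℕP.<⇒≤ m<r)) ⟩
    Σ[ w ∈ level (suc (suc m)) ] f w ℚ.+ Σ[ w ∈ staircase (suc m) ] f w
      ≡⟨ Σ-++ f (level (suc (suc m))) (staircase (suc m)) ⟨
    Σ[ w ∈ staircase (suc (suc m)) ] f w ∎
    where
    open ℚP.≤-Reasoning
    f : Vtx → ℚ
    f w = invSq (dist n a w)

Σ-invSq-≥ : ∀ {n m a} → a ∈ V n → LargeCoordinate a (suc m) →
            harmonicBound m ℚ.≤ Σ[ w ∈ others n a ] invSq (dist n a w)
Σ-invSq-≥ {n} {m} {a} a∈V large = ℚP.≤-trans (Σ-staircase-≥ m ℕP.≤-refl)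
  (Σ-mono-⊆ (λ w → invSq (dist n a w)) (λ w → invSq-nonNeg (dist n a w))
    (Unique-staircase (suc m) (LargeCoordinate.r≤∣p∣ large)) (staircase-⊆-others ℕP.≤-refl))
  where open Staircase {n} a∈V large

-- The union bound in the OSW model

fromBool : Bool → ℕ
fromBool b = if b then 1 else 0

𝟙 : Bool → ℚ
𝟙 b = fromℕ (fromBool b)

𝟙-nonNeg : ∀ b → 0ℚ ℚ.≤ 𝟙 b
𝟙-nonNeg b = fromℕ-nonNeg (fromBool b)

module _ (n : ℕ) where

  Σ-invSq-nonNeg : ∀ a → 0ℚ ℚ.≤ Σ[ w ∈ others n a ] invSq (dist n a w)
  Σ-invSq-nonNeg a = Σ-nonNeg (others n a) (λ {w} _ → invSq-nonNeg (dist n a w))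

  Z-nonNeg : ∀ a → 0ℚ ℚ.≤ Z n a
  Z-nonNeg a = inv-nonNeg (Σ-invSq-nonNeg a)

  PrC-nonNeg : ∀ a b → 0ℚ ℚ.≤ PrC n a b
  PrC-nonNeg a b = *-nonNeg (Z-nonNeg a) (invSq-nonNeg (dist n a b))

  weight-nonNeg : ∀ ω → 0ℚ ℚ.≤ weight n ω
  weight-nonNeg []            = 0≤1
  weight-nonNeg ((a , b) ∷ ω) = *-nonNeg (PrC-nonNeg a b) (weight-nonNeg ω)

  Σweight-nonNeg : ∀ Ω → 0ℚ ℚ.≤ Σ[ ω ∈ Ω ] weight n ω
  Σweight-nonNeg Ω = Σ-nonNeg Ω (λ {ω} _ → weight-nonNeg ω)

  ΣPrC≡Z*Σ : ∀ a → Σ[ b ∈ others n a ] PrC n a b ≡ Z n a ℚ.* Σ[ w ∈ others n a ] invSq (dist n a w)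
  ΣPrC≡Z*Σ a = Σ-*ˡ (Z n a) (λ w → invSq (dist n a w)) (others n a)

  ΣPrC≤1 : ∀ a → Σ[ b ∈ others n a ] PrC n a b ℚ.≤ 1ℚ
  ΣPrC≤1 a = ℚP.≤-trans (ℚP.≤-reflexive (ΣPrC≡Z*Σ a)) (inv*p≤1 (Σ[ w ∈ others n a ] invSq (dist n a w)))

  ΣPrC-nonNeg : ∀ a → 0ℚ ℚ.≤ Σ[ b ∈ others n a ] PrC n a b
  ΣPrC-nonNeg a = Σ-nonNeg (others n a) (λ {b} _ → PrC-nonNeg a b)

  Σweight-extend : ∀ a b Ω → Σ[ ω ∈ map ((a , b) ∷_) Ω ] weight n ω ≡ PrC n a b ℚ.* Σ[ ω ∈ Ω ] weight n ω
  Σweight-extend a b Ω = trans (cong sumℚ (sym (LP.map-∘ Ω))) (Σ-*ˡ (PrC n a b) (weight n) Ω)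

  Σweight-outcomes : ∀ a as → Σ[ ω ∈ outcomesFrom n (a ∷ as) ] weight n ω
                              ≡ (Σ[ b ∈ others n a ] PrC n a b) ℚ.* Σ[ ω ∈ outcomesFrom n as ] weight n ω
  Σweight-outcomes a as = trans (Σ-concatMap (weight n) (λ b → map ((a , b) ∷_) (outcomesFrom n as)) (others n a))
    (trans (Σ-cong (others n a) (λ {b} _ → Σweight-extend a b (outcomesFrom n as)))
           (Σ-*ʳ _ (PrC n a) (others n a)))

  Σweight≤1 : ∀ as → Σ[ ω ∈ outcomesFrom n as ] weight n ω ℚ.≤ 1ℚ
  Σweight≤1 []       = ℚP.≤-refl
  Σweight≤1 (a ∷ as) = ℚP.≤-trans (ℚP.≤-reflexive (Σweight-outcomes a as))
    (ℚP.≤-trans (*-mono-≤ (ΣPrC-nonNeg a) 0≤1 (ΣPrC≤1 a) (Σweight≤1 as)) (ℚP.≤-reflexive (ℚP.*-identityˡ 1ℚ)))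

  module _ (p : Vtx × Vtx → Bool) where

    Pr-any : List Vtx → ℚ
    Pr-any as = Σ[ ω ∈ boolFilter (any p) (outcomesFrom n as) ] weight n ω

    Pr-any-nonNeg : ∀ as → 0ℚ ℚ.≤ Pr-any as
    Pr-any-nonNeg as = Σweight-nonNeg (boolFilter (any p) (outcomesFrom n as))

    Pr-choice : Vtx → ℚ
    Pr-choice a = Σ[ b ∈ others n a ] (PrC n a b ℚ.* 𝟙 (p (a , b)))

    Pr-any-extend : ∀ a b as → Σ[ ω ∈ boolFilter (any p) (map ((a , b) ∷_) (outcomesFrom n as)) ] weight n ω
                               ℚ.≤ PrC n a b ℚ.* 𝟙 (p (a , b)) ℚ.+ PrC n a b ℚ.* Pr-any as
    Pr-any-extend a b as
      rewrite boolFilter-map (any p) ((a , b) ∷_) (outcomesFrom n as)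
            | Σweight-extend a b (boolFilter (λ ω → p (a , b) ∨ any p ω) (outcomesFrom n as))
      with p (a , b)
    ... | true  = ℚP.≤-trans (*-monoˡ-≤ (PrC-nonNeg a b) Σweight-all≤1)
                             (p≤p+q (*-nonNeg (PrC-nonNeg a b) (Pr-any-nonNeg as)))
      where
      Σweight-all≤1 : Σ[ ω ∈ boolFilter (λ _ → true) (outcomesFrom n as) ] weight n ω ℚ.≤ 1ℚ
      Σweight-all≤1 rewrite boolFilter-const-true (outcomesFrom n as) = Σweight≤1 as
    ... | false = ℚP.≤-reflexive (sym (trans (cong (ℚ._+ (PrC n a b ℚ.* Pr-any as)) (ℚP.*-zeroʳ (PrC n a b)))
                                             (ℚP.+-identityˡ (PrC n a b ℚ.* Pr-any as))))

    Pr-any-∷ : ∀ a as → Pr-any (a ∷ as) ℚ.≤ Pr-choice a ℚ.+ Pr-any as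
    Pr-any-∷ a as = begin
      Pr-any (a ∷ as)
        ≡⟨ cong (λ Ω → Σ[ ω ∈ Ω ] weight n ω)
                (boolFilter-concatMap (any p) (λ b → map ((a , b) ∷_) (outcomesFrom n as)) (others n a)) ⟩
      Σ[ ω ∈ concatMap (λ b → boolFilter (any p) (map ((a , b) ∷_) (outcomesFrom n as))) (others n a) ] weight n ω
        ≡⟨ Σ-concatMap (weight n) extendAny (others n a) ⟩
      Σ[ b ∈ others n a ] Σ[ ω ∈ boolFilter (any p) (map ((a , b) ∷_) (outcomesFrom n as)) ] weight n ω
        ≤⟨ Σ-mono-≤ (others n a) (λ {b} _ → Pr-any-extend a b as) ⟩
      Σ[ b ∈ others n a ] (PrC n a b ℚ.* 𝟙 (p (a , b)) ℚ.+ PrC n a b ℚ.* Pr-any as)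
        ≡⟨ Σ-+ (λ b → PrC n a b ℚ.* 𝟙 (p (a , b))) (λ b → PrC n a b ℚ.* Pr-any as) (others n a) ⟩
      Pr-choice a ℚ.+ Σ[ b ∈ others n a ] (PrC n a b ℚ.* Pr-any as)
        ≡⟨ cong (Pr-choice a ℚ.+_) (Σ-*ʳ (Pr-any as) (PrC n a) (others n a)) ⟩
      Pr-choice a ℚ.+ (Σ[ b ∈ others n a ] PrC n a b) ℚ.* Pr-any as
        ≤⟨ ℚP.+-monoʳ-≤ (Pr-choice a)
             (ℚP.≤-trans (*-monoʳ-≤ (Pr-any-nonNeg as) (ΣPrC≤1 a)) (ℚP.≤-reflexive (ℚP.*-identityˡ (Pr-any as)))) ⟩
      Pr-choice a ℚ.+ Pr-any as ∎
      where
      open ℚP.≤-Reasoning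
      extendAny : Vtx → List Outcome
      extendAny b = boolFilter (any p) (map ((a , b) ∷_) (outcomesFrom n as))

    union-bound : ∀ as → Pr-any as ℚ.≤ Σ[ a ∈ as ] Pr-choice a
    union-bound []       = ℚP.≤-refl
    union-bound (a ∷ as) = ℚP.≤-trans (Pr-any-∷ a as) (ℚP.+-monoʳ-≤ (Pr-choice a) (union-bound as))

E2-pair : Vtx → Vtx → Vtx → Bool
E2-pair u a b = not (a ==V u) ∧ not (b ==V u) ∧ not (a ==V b) ∧ adj u a ∧ not (adj a b) ∧ adj b u

E2-pair⁻ : ∀ u a b → E2-pair u a b ≡ true → (a ==V b) ≡ false × adj a b ≡ false × adj u a ≡ true × adj b u ≡ true
E2-pair⁻ u a b eq with a ==V u | b ==V u | a ==V b | adj u a | adj a b | adj b u | eq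
... | false | false | false | true | false | true | _ = refl , refl , refl , refl

_+ᵛ_ : Vtx → Vtx → Vtx
(x , y , z) +ᵛ (x′ , y′ , z′) = (x ℤ.+ x′ , y ℤ.+ y′ , z ℤ.+ z′)

0ᵛ : Vtx
0ᵛ = (+ 0 , + 0 , + 0)

+ᵛ-identityʳ : ∀ u → u +ᵛ 0ᵛ ≡ u
+ᵛ-identityʳ (x , y , z) = cong₂ _,_ (ℤP.+-identityʳ x) (cong₂ _,_ (ℤP.+-identityʳ y) (ℤP.+-identityʳ z))

==ℤ-translate : ∀ a x y → ((a ℤ.+ x) ==ℤ (a ℤ.+ y)) ≡ (x ==ℤ y)
==ℤ-translate a x y = does-⇔ (mk⇔ cancel (cong (ℤ._+_ a))) ((a ℤ.+ x) ℤ.≟ (a ℤ.+ y)) (x ℤ.≟ y)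
  where
  -a+[a+x]≡x : ∀ a x → ℤ.- a ℤ.+ (a ℤ.+ x) ≡ x
  -a+[a+x]≡x = ℤ-Solver.solve-∀
  cancel : a ℤ.+ x ≡ a ℤ.+ y → x ≡ y
  cancel eq = trans (sym (-a+[a+x]≡x a x)) (trans (cong (ℤ._+_ (ℤ.- a)) eq) (-a+[a+x]≡x a y))

close-translate : ∀ a x y → close (a ℤ.+ x) (a ℤ.+ y) ≡ close x y
close-translate a x y = cong (λ d → does (∣ d ∣ ℕ.≤? 1)) ([a+x]-[a+y]≡x-y a x y)
  where
  [a+x]-[a+y]≡x-y : ∀ a x y → (a ℤ.+ x) ℤ.- (a ℤ.+ y) ≡ x ℤ.- y
  [a+x]-[a+y]≡x-y = ℤ-Solver.solve-∀

==V-translate : ∀ u x y → ((u +ᵛ x) ==V (u +ᵛ y)) ≡ (x ==V y)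
==V-translate (u₁ , u₂ , u₃) (x₁ , x₂ , x₃) (y₁ , y₂ , y₃)
  rewrite ==ℤ-translate u₁ x₁ y₁ | ==ℤ-translate u₂ x₂ y₂ | ==ℤ-translate u₃ x₃ y₃ = refl

adj-translate : ∀ u x y → adj (u +ᵛ x) (u +ᵛ y) ≡ adj x y
adj-translate u@(u₁ , u₂ , u₃) x@(x₁ , x₂ , x₃) y@(y₁ , y₂ , y₃)
  rewrite ==V-translate u x y | close-translate u₁ x₁ y₁ | close-translate u₂ x₂ y₂ | close-translate u₃ x₃ y₃ = refl

E2-pair-translate : ∀ u x y → E2-pair u (u +ᵛ x) (u +ᵛ y) ≡ E2-pair 0ᵛ x y
E2-pair-translate u x y = trans (cong (λ v → E2-pair v (u +ᵛ x) (u +ᵛ y)) (sym (+ᵛ-identityʳ u)))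
  (shape-cong (==V-translate u x 0ᵛ) (==V-translate u y 0ᵛ) (==V-translate u x y)
              (adj-translate u 0ᵛ x) (adj-translate u x y) (adj-translate u y 0ᵛ))
  where
  shape : Bool → Bool → Bool → Bool → Bool → Bool → Bool
  shape e₁ e₂ e₃ a₁ a₂ a₃ = not e₁ ∧ not e₂ ∧ not e₃ ∧ a₁ ∧ not a₂ ∧ a₃
  shape-cong : ∀ {e₁ e₂ e₃ a₁ a₂ a₃ e₁′ e₂′ e₃′ a₁′ a₂′ a₃′} → e₁ ≡ e₁′ → e₂ ≡ e₂′ → e₃ ≡ e₃′ → a₁ ≡ a₁′ → a₂ ≡ a₂′ → a₃ ≡ a₃′ →
               shape e₁ e₂ e₃ a₁ a₂ a₃ ≡ shape e₁′ e₂′ e₃′ a₁′ a₂′ a₃′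
  shape-cong refl refl refl refl refl refl = refl

units : List ℤ
units = -[1+ 0 ] ∷ + 0 ∷ + 1 ∷ []

offsets : List Vtx
offsets = cartesianProduct units (cartesianProduct units units)

∈-units⁺ : ∀ {c} → ∣ c ∣ ≤ 1 → c ∈ units
∈-units⁺ {+ 0}            _ = there (here refl)
∈-units⁺ {+ 1}            _ = there (there (here refl))
∈-units⁺ {+ suc (suc _)}  (ℕ.s≤s ())
∈-units⁺ { -[1+ 0 ]}      _ = here refl
∈-units⁺ { -[1+ suc _ ]}  (ℕ.s≤s ())

==V-sym : ∀ v w → (v ==V w) ≡ (w ==V v)
==V-sym v w with v ==V w in eq
... | true  = sym (trans (cong (w ==V_) (==V⇒≡ eq)) (==V-refl w))
... | false = sym (≢⇒==V-false (λ w≡v → ==V-false⇒≢ {v} {w} eq (sym w≡v)))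

adj-sym : ∀ v w → adj v w ≡ adj w v
adj-sym v@(x , y , z) w@(x′ , y′ , z′)
  rewrite ==V-sym v w | close-sym x x′ | close-sym y y′ | close-sym z z′ = refl

adj⇒∈translates : ∀ u v → adj u v ≡ true → v ∈ map (u +ᵛ_) offsets
adj⇒∈translates u@(u₁ , u₂ , u₃) v@(v₁ , v₂ , v₃) u~v with adj⁻ {u₁} {u₂} {u₃} {v₁} {v₂} {v₃} u~v
... | c₁ , c₂ , c₃ = subst (_∈ map (u +ᵛ_) offsets) (cong₂ _,_ (u+[v-u]≡v u₁ v₁) (cong₂ _,_ (u+[v-u]≡v u₂ v₂) (u+[v-u]≡v u₃ v₃)))
  (∈-map⁺ (u +ᵛ_) (∈-cartesianProduct⁺ (diff∈units u₁ v₁ c₁) (∈-cartesianProduct⁺ (diff∈units u₂ v₂ c₂) (diff∈units u₃ v₃ c₃))))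
  where
  u+[v-u]≡v : ∀ a b → a ℤ.+ (b ℤ.- a) ≡ b
  u+[v-u]≡v = ℤ-Solver.solve-∀
  diff∈units : ∀ a b → close a b ≡ true → b ℤ.- a ∈ units
  diff∈units a b c = ∈-units⁺ (subst (_≤ 1) (ℤP.∣i-j∣≡∣j-i∣ a b) (close⁻ a b c))

Σ-≤-Σ-offsets : ∀ u (f : Vtx → ℚ) {xs} → Unique xs → (∀ x → 0ℚ ℚ.≤ f x) → (∀ x → adj u x ≡ false → f x ≡ 0ℚ) →
                Σ[ x ∈ xs ] f x ℚ.≤ Σ[ d ∈ offsets ] f (u +ᵛ d)
Σ-≤-Σ-offsets u f {xs} !xs 0≤f f≡0 = begin
  Σ[ x ∈ xs ] f x                            ≡⟨ Σ-boolFilter (adj u) f xs f≡0 ⟨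
  Σ[ x ∈ boolFilter (adj u) xs ] f x         ≤⟨ Σ-mono-⊆ f 0≤f (Unique-boolFilter (adj u) !xs)
                                                  (λ {x} x∈ → adj⇒∈translates u x (proj₂ (∈-boolFilter⁻ (adj u) xs x∈))) ⟩
  Σ[ x ∈ map (u +ᵛ_) offsets ] f x          ≡⟨ cong sumℚ (LP.map-∘ {g = f} {f = u +ᵛ_} offsets) ⟨
  Σ[ d ∈ offsets ] f (u +ᵛ d)                ∎
  where open ℚP.≤-Reasoning

data Sgn : Set where
  pos nil neg : Sgn

sgn : ℤ → Sgn
sgn (+ zero)  = nil
sgn +[1+ _ ]  = pos
sgn -[1+ _ ]  = neg

Pattern : Set
Pattern = Sgn × Sgn × Sgn

signs : Vtx → Pattern
signs (x , y , z) = (sgn x , sgn y , sgn z)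

δ : Sgn → ℤ → ℤ
δ pos c = c
δ neg c = ℤ.- c
δ nil c = + ∣ c ∣

∣x+c∣≡∣x∣+δ : ∀ x {c} → c ∈ units → + ∣ x ℤ.+ c ∣ ≡ + ∣ x ∣ ℤ.+ δ (sgn x) c
∣x+c∣≡∣x∣+δ (+ zero)        (here refl)                 = refl
∣x+c∣≡∣x∣+δ (+ zero)        (there (here refl))         = refl
∣x+c∣≡∣x∣+δ (+ zero)        (there (there (here refl))) = refl
∣x+c∣≡∣x∣+δ +[1+ m ]        (here refl)                 = refl
∣x+c∣≡∣x∣+δ +[1+ m ]        (there (here refl))         = refl
∣x+c∣≡∣x∣+δ +[1+ m ]        (there (there (here refl))) = refl
∣x+c∣≡∣x∣+δ -[1+ m ]        (here refl)                 = cong (λ k → + suc k) (trans (ℕP.+-identityʳ (suc m)) (ℕP.+-comm 1 m))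
∣x+c∣≡∣x∣+δ -[1+ m ]        (there (here refl))         = cong +_ (sym (ℕP.+-identityʳ (suc m)))
∣x+c∣≡∣x∣+δ -[1+ zero ]     (there (there (here refl))) = refl
∣x+c∣≡∣x∣+δ -[1+ suc m ]    (there (there (here refl))) = refl

onSphere : Pattern → Vtx → Bool
onSphere (s₁ , s₂ , s₃) (d₁ , d₂ , d₃) = does (δ s₁ d₁ ℤ.+ δ s₂ d₂ ℤ.+ δ s₃ d₃ ℤ.≟ + 0)

inV : ℕ → Vtx → Bool
inV n v = does (norm₁ v ℕ.≟ n)

inV-true : ∀ {n v} → v ∈ V n → inV n v ≡ true
inV-true {n} {v} v∈V = dec-true (norm₁ v ℕ.≟ n) (∈V⁻ v∈V)

+norm₁ : ∀ v → + norm₁ v ≡ + ∣ proj₁ v ∣ ℤ.+ + ∣ proj₁ (proj₂ v) ∣ ℤ.+ + ∣ proj₂ (proj₂ v) ∣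
+norm₁ (x , y , z) = trans (ℤP.pos-+ (∣ x ∣ ℕ.+ ∣ y ∣) ∣ z ∣) (cong (ℤ._+ + ∣ z ∣) (ℤP.pos-+ ∣ x ∣ ∣ y ∣))

inV-translate : ∀ u d → d ∈ offsets → inV (norm₁ u) (u +ᵛ d) ≡ onSphere (signs u) d
inV-translate u@(u₁ , u₂ , u₃) d@(d₁ , d₂ , d₃) d∈ with ∈-cartesianProduct⁻ units (cartesianProduct units units) d∈
... | d₁∈ , d₂₃∈ with ∈-cartesianProduct⁻ units units d₂₃∈
...   | d₂∈ , d₃∈ = does-⇔ (mk⇔ Δ≡0 norm-preserved) (norm₁ (u +ᵛ d) ℕ.≟ N) (Δ ℤ.≟ + 0)
  where
  N : ℕ
  N = norm₁ u
  Δ : ℤ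
  Δ = δ (sgn u₁) d₁ ℤ.+ δ (sgn u₂) d₂ ℤ.+ δ (sgn u₃) d₃
  regroup : ∀ a b c x y z → (a ℤ.+ x) ℤ.+ (b ℤ.+ y) ℤ.+ (c ℤ.+ z) ≡ (a ℤ.+ b ℤ.+ c) ℤ.+ (x ℤ.+ y ℤ.+ z)
  regroup = ℤ-Solver.solve-∀
  [a+b]-a≡b : ∀ a b → a ℤ.+ b ℤ.- a ≡ b
  [a+b]-a≡b = ℤ-Solver.solve-∀
  norm-shift : + norm₁ (u +ᵛ d) ≡ + N ℤ.+ Δ
  norm-shift = begin
    + norm₁ (u +ᵛ d)
      ≡⟨ +norm₁ (u +ᵛ d) ⟩
    + ∣ u₁ ℤ.+ d₁ ∣ ℤ.+ + ∣ u₂ ℤ.+ d₂ ∣ ℤ.+ + ∣ u₃ ℤ.+ d₃ ∣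
      ≡⟨ cong₂ ℤ._+_ (cong₂ ℤ._+_ (∣x+c∣≡∣x∣+δ u₁ d₁∈) (∣x+c∣≡∣x∣+δ u₂ d₂∈)) (∣x+c∣≡∣x∣+δ u₃ d₃∈) ⟩
    (+ ∣ u₁ ∣ ℤ.+ δ (sgn u₁) d₁) ℤ.+ (+ ∣ u₂ ∣ ℤ.+ δ (sgn u₂) d₂) ℤ.+ (+ ∣ u₃ ∣ ℤ.+ δ (sgn u₃) d₃)
      ≡⟨ regroup (+ ∣ u₁ ∣) (+ ∣ u₂ ∣) (+ ∣ u₃ ∣) (δ (sgn u₁) d₁) (δ (sgn u₂) d₂) (δ (sgn u₃) d₃) ⟩
    (+ ∣ u₁ ∣ ℤ.+ + ∣ u₂ ∣ ℤ.+ + ∣ u₃ ∣) ℤ.+ Δ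
      ≡⟨ cong (ℤ._+ Δ) (+norm₁ u) ⟨
    + N ℤ.+ Δ ∎
    where open ≡-Reasoning
  Δ≡0 : norm₁ (u +ᵛ d) ≡ N → Δ ≡ + 0
  Δ≡0 eq = begin
    Δ                      ≡⟨ [a+b]-a≡b (+ N) Δ ⟨
    + N ℤ.+ Δ ℤ.- + N      ≡⟨ cong (ℤ._- + N) (trans (sym norm-shift) (cong +_ eq)) ⟩
    + N ℤ.- + N            ≡⟨ ℤP.+-inverseʳ (+ N) ⟩
    + 0                    ∎
    where open ≡-Reasoning
  norm-preserved : Δ ≡ + 0 → norm₁ (u +ᵛ d) ≡ N
  norm-preserved Δ≡0 = ℤP.+-injective (trans norm-shift (trans (cong (ℤ._+_ (+ N)) Δ≡0) (ℤP.+-identityʳ (+ N))))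

pairCount : Pattern → ℕ
pairCount t = sum (map (λ d → sum (map (λ d′ → fromBool (onSphere t d ∧ onSphere t d′ ∧ E2-pair 0ᵛ d d′)) offsets)) offsets)

sgns : List Sgn
sgns = pos ∷ nil ∷ neg ∷ []

∈-sgns : ∀ s → s ∈ sgns
∈-sgns pos = here refl
∈-sgns nil = there (here refl)
∈-sgns neg = there (there (here refl))

patterns : List Pattern
patterns = cartesianProduct sgns (cartesianProduct sgns sgns)

∈-patterns : ∀ t → t ∈ patterns
∈-patterns (s₁ , s₂ , s₃) = ∈-cartesianProduct⁺ (∈-sgns s₁) (∈-cartesianProduct⁺ (∈-sgns s₂) (∈-sgns s₃))

pairCount≤18 : ∀ t → pairCount t ≤ 18
pairCount≤18 t = All.lookup (toWitness {a? = All.all? (λ t → pairCount t ℕ.≤? 18) patterns} _) (∈-patterns t)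

𝟙≡0 : ∀ {b c} → (b ≡ true → c ≡ true) → c ≡ false → 𝟙 b ≡ 0ℚ
𝟙≡0 {false} _   _  = refl
𝟙≡0 {true}  b⇒c c≡false = ⊥-elim (true≢false (trans (sym (b⇒c refl)) c≡false))

module _ {n u} (u∈V : u ∈ V n) where

  E2-pairOn : Vtx → Vtx → Bool
  E2-pairOn a b = inV n a ∧ inV n b ∧ E2-pair u a b

  E2-pairOn⇒adj : ∀ a b → E2-pairOn a b ≡ true → adj u a ≡ true × adj u b ≡ true
  E2-pairOn⇒adj a b eq with inV n a | inV n b | E2-pair u a b in e | eq
  ... | true | true | true | _ = let _ , _ , u~a , b~u = E2-pair⁻ u a b e in u~a , trans (adj-sym u b) b~u

  Σ-E2-pair-≤ : ∀ {a} → a ∈ V n → Σ[ b ∈ others n a ] 𝟙 (E2-pair u a b) ℚ.≤ Σ[ d′ ∈ offsets ] 𝟙 (E2-pairOn a (u +ᵛ d′))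
  Σ-E2-pair-≤ {a} a∈V = begin
    Σ[ b ∈ others n a ] 𝟙 (E2-pair u a b)
      ≡⟨ Σ-cong (others n a) (λ {b} b∈ → cong 𝟙 (sym (cong₂ (λ p q → p ∧ q ∧ E2-pair u a b) (inV-true {n} a∈V)
                                                          (inV-true {n} (proj₁ (∈-boolFilter⁻ _ (V n) b∈)))))) ⟩
    Σ[ b ∈ others n a ] 𝟙 (E2-pairOn a b)
      ≤⟨ Σ-≤-Σ-offsets u (λ b → 𝟙 (E2-pairOn a b)) (Unique-boolFilter _ (Unique-V n)) (λ b → 𝟙-nonNeg (E2-pairOn a b))
           (λ b → 𝟙≡0 (proj₂ ∘ E2-pairOn⇒adj a b)) ⟩
    Σ[ d′ ∈ offsets ] 𝟙 (E2-pairOn a (u +ᵛ d′)) ∎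
    where open ℚP.≤-Reasoning

  E2-pairOn-translate : ∀ {d d′} → d ∈ offsets → d′ ∈ offsets →
                        E2-pairOn (u +ᵛ d) (u +ᵛ d′) ≡ (onSphere (signs u) d ∧ onSphere (signs u) d′ ∧ E2-pair 0ᵛ d d′)
  E2-pairOn-translate {d} {d′} d∈ d′∈ =
    trans (cong (λ m → inV m (u +ᵛ d) ∧ inV m (u +ᵛ d′) ∧ E2-pair u (u +ᵛ d) (u +ᵛ d′)) (sym (∈V⁻ u∈V)))
          (cong₂ _∧_ (inV-translate u d d∈) (cong₂ _∧_ (inV-translate u d′ d′∈) (E2-pair-translate u d d′)))

  Σ-E2-pair≤18 : Σ[ a ∈ V n ] Σ[ b ∈ others n a ] 𝟙 (E2-pair u a b) ℚ.≤ fromℕ 18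
  Σ-E2-pair≤18 = begin
    Σ[ a ∈ V n ] Σ[ b ∈ others n a ] 𝟙 (E2-pair u a b)
      ≤⟨ Σ-mono-≤ (V n) Σ-E2-pair-≤ ⟩
    Σ[ a ∈ V n ] Σ[ d′ ∈ offsets ] 𝟙 (E2-pairOn a (u +ᵛ d′))
      ≤⟨ Σ-≤-Σ-offsets u (λ a → Σ[ d′ ∈ offsets ] 𝟙 (E2-pairOn a (u +ᵛ d′))) (Unique-V n)
           (λ a → Σ-nonNeg offsets (λ {d′} _ → 𝟙-nonNeg (E2-pairOn a (u +ᵛ d′))))
           (λ a u≁a → trans (Σ-cong offsets (λ {d′} _ → 𝟙≡0 (proj₁ ∘ E2-pairOn⇒adj a (u +ᵛ d′)) u≁a)) (Σ-0 offsets)) ⟩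
    Σ[ d ∈ offsets ] Σ[ d′ ∈ offsets ] 𝟙 (E2-pairOn (u +ᵛ d) (u +ᵛ d′))
      ≡⟨ Σ-cong offsets (λ d∈ → Σ-cong offsets (λ d′∈ → cong 𝟙 (E2-pairOn-translate d∈ d′∈))) ⟩
    Σ[ d ∈ offsets ] Σ[ d′ ∈ offsets ] fromℕ (fromBool (onSphere t d ∧ onSphere t d′ ∧ E2-pair 0ᵛ d d′))
      ≡⟨ Σ-cong offsets (λ {d} _ → Σ-fromℕ (λ d′ → fromBool (onSphere t d ∧ onSphere t d′ ∧ E2-pair 0ᵛ d d′)) offsets) ⟩
    Σ[ d ∈ offsets ] fromℕ (sum (map (λ d′ → fromBool (onSphere t d ∧ onSphere t d′ ∧ E2-pair 0ᵛ d d′)) offsets))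
      ≡⟨ Σ-fromℕ (λ d → sum (map (λ d′ → fromBool (onSphere t d ∧ onSphere t d′ ∧ E2-pair 0ᵛ d d′)) offsets)) offsets ⟩
    fromℕ (pairCount t)
      ≤⟨ fromℕ-mono-≤ (pairCount≤18 t) ⟩
    fromℕ 18 ∎
    where
    open ℚP.≤-Reasoning
    t : Pattern
    t = signs u

module _ {n u L} (u∈V : u ∈ V n) (0<L : 0ℚ ℚ.< L)
         (L≤Σ : ∀ {a} → a ∈ V n → L ℚ.≤ Σ[ w ∈ others n a ] invSq (dist n a w)) where

  PrC≤ : ∀ {a b} → a ∈ V n → E2-pair u a b ≡ true → PrC n a b ℚ.≤ inv L ℚ.* (+ 1 / 4)
  PrC≤ {a} {b} a∈V e2 = *-mono-≤ (Z-nonNeg n a) (ℚP.nonNegative⁻¹ (+ 1 / 4))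
    (inv-antimono-≤ 0<L (L≤Σ a∈V)) (invSq≤1/4 d≢1)
    where
    d≢1 : dist n a b ≢ 1
    d≢1 d≡1 with E2-pair⁻ u a b e2
    ... | a≠b , a≁b , _ = true≢false (trans (sym (dist≡1⇒adj {n} {a} {b} (==V-false⇒≢ a≠b) d≡1)) a≁b)

  Pr-E2≤ : Pr n (E2 n u) ℚ.≤ + 9 / 2 ℚ.* inv L
  Pr-E2≤ = begin
    Pr n (E2 n u)
      ≤⟨ union-bound n (λ ab → E2-pair u (proj₁ ab) (proj₂ ab)) (V n) ⟩
    Σ[ a ∈ V n ] Σ[ b ∈ others n a ] (PrC n a b ℚ.* 𝟙 (E2-pair u a b))
      ≤⟨ Σ-mono-≤ (V n) (λ {a} a∈V → Σ-mono-≤ (others n a) (λ {b} _ → term≤ a∈V b)) ⟩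
    Σ[ a ∈ V n ] Σ[ b ∈ others n a ] (𝟙 (E2-pair u a b) ℚ.* q)
      ≡⟨ Σ-cong (V n) (λ {a} _ → Σ-*ʳ q (λ b → 𝟙 (E2-pair u a b)) (others n a)) ⟩
    Σ[ a ∈ V n ] ((Σ[ b ∈ others n a ] 𝟙 (E2-pair u a b)) ℚ.* q)
      ≡⟨ Σ-*ʳ q (λ a → Σ[ b ∈ others n a ] 𝟙 (E2-pair u a b)) (V n) ⟩
    (Σ[ a ∈ V n ] Σ[ b ∈ others n a ] 𝟙 (E2-pair u a b)) ℚ.* q
      ≤⟨ *-monoʳ-≤ 0≤q (Σ-E2-pair≤18 {n} u∈V) ⟩
    fromℕ 18 ℚ.* (inv L ℚ.* (+ 1 / 4))
      ≡⟨ solve 1 (λ i → con (fromℕ 18) :* (i :* con (+ 1 / 4)) := con (+ 9 / 2) :* i) refl (inv L) ⟩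
    + 9 / 2 ℚ.* inv L ∎
    where
    open ℚP.≤-Reasoning
    q : ℚ
    q = inv L ℚ.* (+ 1 / 4)
    0≤q : 0ℚ ℚ.≤ q
    0≤q = *-nonNeg (inv-nonNeg (ℚP.<⇒≤ 0<L)) (ℚP.nonNegative⁻¹ (+ 1 / 4))
    term≤ : ∀ {a} → a ∈ V n → ∀ b → PrC n a b ℚ.* 𝟙 (E2-pair u a b) ℚ.≤ 𝟙 (E2-pair u a b) ℚ.* q
    term≤ {a} a∈V b with E2-pair u a b in e2
    ... | true  = ℚP.≤-trans (ℚP.≤-reflexive (ℚP.*-identityʳ (PrC n a b)))
                    (ℚP.≤-trans (PrC≤ a∈V e2) (ℚP.≤-reflexive (sym (ℚP.*-identityˡ q))))
    ... | false = ℚP.≤-reflexive (trans (ℚP.*-zeroʳ (PrC n a b)) (sym (ℚP.*-zeroˡ q)))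

3[k/3]<1+k : ∀ k → 3 ℕ.* (k ℕ./ 3) < suc k
3[k/3]<1+k k = ℕ.s≤s (subst (_≤ k) (ℕP.*-comm (k ℕ./ 3) 3) (m/n*n≤m k 3))

1+k≤3[k/3+1] : ∀ k → suc k ≤ 3 ℕ.* suc (k ℕ./ 3)
1+k≤3[k/3+1] k = begin
  suc k                               ≡⟨ cong suc (m≡m%n+[m/n]*n k 3) ⟩
  suc (k % 3 ℕ.+ k ℕ./ 3 ℕ.* 3)       ≤⟨ ℕP.+-monoˡ-≤ (k ℕ./ 3 ℕ.* 3) (m%n<n k 3) ⟩
  3 ℕ.+ k ℕ./ 3 ℕ.* 3                 ≡⟨ 3+m*3≡3*[1+m] (k ℕ./ 3) ⟩
  3 ℕ.* suc (k ℕ./ 3)                 ∎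
  where
  open ℕP.≤-Reasoning
  3+m*3≡3*[1+m] : ∀ m → 3 ℕ.+ m ℕ.* 3 ≡ 3 ℕ.* suc m
  3+m*3≡3*[1+m] = ℕ-Solver.solve-∀

lemma6 : (n : ℕ) → 1 ≤ n → (u : Vtx) → u ∈ V n →
    LtMulInvLn (Pr n (E2 n u)) ((+ 9) / 2) (suc n)
lemma6 (suc k) _ u u∈V =
  LtMulInvLn-intro {c = + 9 / 2} {n = suc (suc k)} {N = 16 ℕ.+ m}
    (harmonicBound-pos m) (Pr-E2≤ {suc k} u∈V (harmonicBound-pos m) L≤Σ) (expPartial-bound {suc k} {m} (1+k≤3[k/3+1] k))
  where
  m : ℕ
  m = k ℕ./ 3
  L≤Σ : ∀ {a} → a ∈ V (suc k) → harmonicBound m ℚ.≤ Σ[ w ∈ others (suc k) a ] invSq (dist (suc k) a w)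
  L≤Σ a∈V = Σ-invSq-≥ {suc k} {m} a∈V (pigeonhole _ (subst (3 ℕ.* m <_) (sym (∈V⁻ a∈V)) (3[k/3]<1+k k)))
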